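{- Let $k\geq 2$ and $n>18k^{2}-24k+10$ be integers. Then there is no uniquely $C_4^{+}$-saturated graph on $n$ vertices with exactly $k$ triangles.
   Context: All graphs are finite, simple and undirected. $C_4^{+}$ (the diamond) is the graph obtained from a $4$-cycle by adding one chord, i.e. $K_4$ minus an edge. For a graph $H$, a graph $G$ is uniquely $H$-saturated if $G$ contains no subgraph isomorphic to $H$, but for every pair of non-adjacent vertices $u,v$ of $G$, the graph $G+uv$ contains exactly one subgraph isomorphic to $H$. A triangle is a subgraph isomorphic to $K_3$; the number of triangles is the number of such subgraphs. -}

module Defs where

open import Data.Nat using (ℕ; zero; suc; _+_)
open import Data.Bool using (Bool; true; false; _∧_; _∨_; not; if_then_else_)
open import Data.Fin using (Fin; _≟_; _<?_)
open import Data.List using (List; allFin; map)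
open import Data.Nat.ListAction using (sum)
open import Data.Product using (_×_)
open import Relation.Nullary.Decidable using (⌊_⌋)
open import Relation.Binary.PropositionalEquality using (_≡_; _≢_)

Adj : ℕ → Set
Adj n = Fin n → Fin n → Bool

record Graph (n : ℕ) : Set where
  field
    adj    : Adj n
    sym    : ∀ i j → adj i j ≡ adj j i
    irrefl : ∀ i → adj i i ≡ false
open Graph public

sumFin : ∀ {n} → (Fin n → ℕ) → ℕ
sumFin {n} f = sum (map f (allFin n))

𝟙 : Bool → ℕ
𝟙 b = if b then 1 else 0

_≠ᵇ_ : ∀ {n} → Fin n → Fin n → Bool
i ≠ᵇ j = not ⌊ i ≟ j ⌋

_<ᵇ_ : ∀ {n} → Fin n → Fin n → Bool
i <ᵇ j = ⌊ i <? j ⌋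

addEdge : ∀ {n} → Adj n → Fin n → Fin n → Adj n
addEdge A u v i j =
  A i j ∨ ((⌊ i ≟ u ⌋ ∧ ⌊ j ≟ v ⌋) ∨ (⌊ i ≟ v ⌋ ∧ ⌊ j ≟ u ⌋))

triangles : ∀ {n} → Adj n → ℕ
triangles A = sumFin λ a → sumFin λ b → sumFin λ c → 𝟙 (
  (a <ᵇ b) ∧ (b <ᵇ c) ∧ A a b ∧ A a c ∧ A b c)

-- Number of subgraphs isomorphic to the diamond C₄⁺ = K₄ minus an edge.
-- Such a subgraph is determined by its edge set
--   {ab, ac, bc, ad, bd}  with a,b,c,d distinct,
-- where {a,b} is the chord (the two degree-3 vertices) and {c,d} the two
-- degree-2 vertices; we count it once by requiring a < b and c < d.
diamonds : ∀ {n} → Adj n → ℕ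
diamonds A = sumFin λ a → sumFin λ b → sumFin λ c → sumFin λ d → 𝟙 (
  (a <ᵇ b) ∧ (c <ᵇ d) ∧ (a ≠ᵇ c) ∧ (a ≠ᵇ d) ∧ (b ≠ᵇ c) ∧ (b ≠ᵇ d)
  ∧ A a b ∧ A a c ∧ A b c ∧ A a d ∧ A b d)

UniquelyDiamondSaturated : ∀ {n} → Graph n → Set
UniquelyDiamondSaturated G =
  diamonds (adj G) ≡ 0 ×
  (∀ u v → u ≢ v → adj G u v ≡ false → diamonds (addEdge (adj G) u v) ≡ 1)

-- In a uniquely C₄⁺-saturated graph every edge lies in at most one triangle, and for a non-edge vw
-- the unique diamond of G + vw has vw either as its chord (v and w have exactly two common
-- neighbours, joined to them by edges in no triangle) or as a side (a common neighbour x, with a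
-- triangle on vx or on xw, but not on both). Hence every vertex lies in at most one triangle, and
-- the number β of triangle-free ("plain") edges at a vertex is the same at both ends of a plain edge.
-- Weighting each common neighbour x of v and a non-neighbour w by 1 + [vx in a triangle] +
-- [xw in a triangle] gives total weight 2 for every w; summing over x first instead yields
--   2n = 2 + β(v) (β(v) + 1) + 2 (t(v) + Σ_{vx in a triangle} β(x) + Σ_{vx plain} t(x)),
-- where t(x) ∈ {0, 2} counts the triangle edges at x. Plain neighbours of v lying in triangles lie
-- in distinct triangles, so the last sum is at most 2k. If every vertex is in a triangle, then β ≤ k
-- everywhere and 2n ≤ k² + 9k + 6; otherwise comparing the equations of a vertex outside all
-- triangles and of a suitable triangle gives β ≤ 2k + 1 there and 2n ≤ 4k² + 10k + 4. Both bounds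
-- contradict n > 18k² − 24k + 10.

module Submission where

open import Defs hiding (sym)

open import Data.Bool using (Bool; true; false; _∧_; _∨_; not; T)
open import Data.Bool.Properties using (∧-comm; ∧-identityʳ; ∨-comm; ∨-zeroʳ; T-∧; T-∨; T-≡)
open import Data.Empty using (⊥; ⊥-elim)
open import Data.Fin using (Fin; zero; suc; _≟_; _<?_) renaming (_<_ to _<ᶠ_)
open import Data.Fin.Properties using (suc-injective; 0≢1+n; any?; all?; ¬∀⟶∃¬; <-cmp; <-trans; <⇒≢)
open import Data.List using (tabulate)
open import Data.List.Properties using (map-tabulate)
open import Data.Nat using (ℕ; zero; suc; _+_; _*_; _∸_; _^_; _≤_; _<_; z≤n; s≤s; _≤?_)
open import Data.Nat.Properties
  using (+-*-semiring; ≤-refl; ≤-reflexive; ≤-trans; ≤-antisym; <⇒≱; ≰⇒>; m≤m+n; m≤n+m; m<m+n;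
         +-comm; +-assoc; *-comm; *-suc; +-identityʳ; *-identityʳ; *-zeroʳ; m+n∸m≡n;
         +-cancelˡ-≡; +-cancelʳ-≡; +-cancelˡ-≤; *-cancelˡ-≡;
         +-mono-≤; +-monoʳ-≤; *-mono-≤; *-monoʳ-≤; *-monoˡ-≤; module ≤-Reasoning)
open import Algebra.Properties.Semiring.Sum +-*-semiring
  using (sum; ∑-distrib-+; ∑-comm; *-distribˡ-sum; *-distribʳ-sum; sum-cong-≗; sum-replicate-zero)
import Data.Nat.ListAction as List
open import Data.Nat.Tactic.RingSolver using (solve-∀)
open import Data.Product using (∃; ∃₂; ∃-syntax; _×_; _,_; proj₁; proj₂)
import Data.Product as Product
open import Data.Sum using (_⊎_; inj₁; inj₂; [_,_]′)
import Data.Sum as Sum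
open import Data.Unit using (⊤; tt)
open import Function using (_∘_; flip; _⇔_; mk⇔; Equivalence)
open import Level using (0ℓ)
open import Relation.Binary using (Decidable; tri<; tri≈; tri>)
open import Relation.Binary.PropositionalEquality
  using (_≡_; _≢_; ≢-sym; refl; sym; trans; cong; cong₂; subst; module ≡-Reasoning)
open import Relation.Nullary using (¬_; Dec; yes; no; does; contradiction)
open import Relation.Nullary.Decidable
  using (_×-dec_; ¬?; T?; ⌊_⌋; dec-true; dec-false; isYes≗does; toSum; toWitness; decidable-stable)
open import Relation.Unary using (Pred; _⊆_) renaming (Decidable to Decidable₁)

-- Finite sums and counting

sum-tabulate : ∀ {n} (f : Fin n → ℕ) → List.sum (tabulate f) ≡ sum f
sum-tabulate {zero}  f = refl
sum-tabulate {suc n} f = cong (f zero +_) (sum-tabulate (f ∘ suc))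

sumFin≡sum : ∀ {n} (f : Fin n → ℕ) → sumFin f ≡ sum f
sumFin≡sum f = trans (cong List.sum (map-tabulate (λ i → i) f)) (sum-tabulate f)

term≤sum : ∀ {n} (f : Fin n → ℕ) i → f i ≤ sum f
term≤sum f zero    = m≤m+n _ _
term≤sum f (suc i) = ≤-trans (term≤sum (f ∘ suc) i) (m≤n+m _ _)

sum-mono-≤ : ∀ {n} {f g : Fin n → ℕ} → (∀ i → f i ≤ g i) → sum f ≤ sum g
sum-mono-≤ {zero}  f≤g = z≤n
sum-mono-≤ {suc n} f≤g = +-mono-≤ (f≤g zero) (sum-mono-≤ (f≤g ∘ suc))

sum-zero : ∀ {n} {f : Fin n → ℕ} → (∀ i → f i ≡ 0) → sum f ≡ 0
sum-zero {n} f≡0 = trans (sum-cong-≗ f≡0) (sum-replicate-zero n)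

sum-pos : ∀ {n} (f : Fin n → ℕ) → 0 < sum f → ∃[ i ] 0 < f i
sum-pos {suc n} f 0<∑ with f zero in eq
... | suc _ = zero , subst (0 <_) (sym eq) (s≤s z≤n)
... | zero  with i , 0<fi ← sum-pos (f ∘ suc) 0<∑ = suc i , 0<fi

sum-support₁ : ∀ {n} (f : Fin n → ℕ) i → (∀ j → j ≢ i → f j ≡ 0) → sum f ≡ f i
sum-support₁ f zero    f≡0 = trans (cong (f zero +_) (sum-zero (λ j → f≡0 (suc j) λ ()))) (+-identityʳ _)
sum-support₁ f (suc i) f≡0 = cong₂ _+_ (f≡0 zero λ ())
  (sum-support₁ (f ∘ suc) i (λ j j≢i → f≡0 (suc j) (j≢i ∘ suc-injective)))

sum-support₂ : ∀ {n} (f : Fin n → ℕ) i j → i ≢ j → (∀ l → l ≢ i → l ≢ j → f l ≡ 0) →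
               sum f ≡ f i + f j
sum-support₂ f zero zero i≢j f≡0 = contradiction refl i≢j
sum-support₂ f zero (suc j) i≢j f≡0 =
  cong (f zero +_) (sum-support₁ (f ∘ suc) j (λ l l≢j → f≡0 (suc l) (λ ()) (l≢j ∘ suc-injective)))
sum-support₂ f (suc i) zero i≢j f≡0 = trans
  (cong (f zero +_) (sum-support₁ (f ∘ suc) i (λ l l≢i → f≡0 (suc l) (l≢i ∘ suc-injective) (λ ()))))
  (+-comm (f zero) _)
sum-support₂ f (suc i) (suc j) i≢j f≡0 = cong₂ _+_ (f≡0 zero (λ ()) (λ ()))
  (sum-support₂ (f ∘ suc) i j (i≢j ∘ cong suc)
    (λ l l≢i l≢j → f≡0 (suc l) (l≢i ∘ suc-injective) (l≢j ∘ suc-injective)))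

sum≤1-unique : ∀ {n} (f : Fin n → ℕ) {i j} → sum f ≤ 1 → 0 < f i → 0 < f j → i ≡ j
sum≤1-unique f {zero}  {zero}  _   _    _    = refl
sum≤1-unique f {zero}  {suc j} ∑≤1 0<fi 0<fj =
  contradiction (≤-trans (+-mono-≤ 0<fi (≤-trans 0<fj (term≤sum (f ∘ suc) j))) ∑≤1) λ { (s≤s ()) }
sum≤1-unique f {suc i} {zero}  ∑≤1 0<fi 0<fj =
  contradiction (≤-trans (+-mono-≤ 0<fj (≤-trans 0<fi (term≤sum (f ∘ suc) i))) ∑≤1) λ { (s≤s ()) }
sum≤1-unique f {suc i} {suc j} ∑≤1 0<fi 0<fj =
  cong suc (sum≤1-unique (f ∘ suc) (≤-trans (m≤n+m _ (f zero)) ∑≤1) 0<fi 0<fj)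

∑∑ : ∀ {m n} → (Fin m → Fin n → ℕ) → ℕ
∑∑ F = sum λ a → sum (F a)

term≤∑∑ : ∀ {m n} (F : Fin m → Fin n → ℕ) a b → F a b ≤ ∑∑ F
term≤∑∑ F a b = ≤-trans (term≤sum (F a) b) (term≤sum (λ a → sum (F a)) a)

∑∑-pos : ∀ {m n} (F : Fin m → Fin n → ℕ) → 0 < ∑∑ F → ∃[ a ] ∃[ b ] 0 < F a b
∑∑-pos F 0<∑ with a , 0<Fa ← sum-pos (λ a → sum (F a)) 0<∑ with b , 0<Fab ← sum-pos (F a) 0<Fa =
  a , b , 0<Fab

∑∑≤1-unique : ∀ {m n} (F : Fin m → Fin n → ℕ) {a a′ b b′} → ∑∑ F ≤ 1 →
              0 < F a b → 0 < F a′ b′ → a ≡ a′ × b ≡ b′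
∑∑≤1-unique F {a} ∑≤1 0<Fab 0<Fa′b′
  with refl ← sum≤1-unique (λ a → sum (F a)) ∑≤1
                (≤-trans 0<Fab (term≤sum (F a) _)) (≤-trans 0<Fa′b′ (term≤sum (F _) _))
  = refl , sum≤1-unique (F a) (≤-trans (term≤sum (λ a → sum (F a)) a) ∑≤1) 0<Fab 0<Fa′b′

𝟙-pos : ∀ {b} → T b → 0 < 𝟙 b
𝟙-pos {true} _ = s≤s z≤n

𝟙-pos⁻¹ : ∀ {b} → 0 < 𝟙 b → T b
𝟙-pos⁻¹ {true} _ = _

⟦_⟧ : ∀ {A : Set} → Dec A → ℕ
⟦ a? ⟧ = 𝟙 (does a?)

⟦⟧-yes : ∀ {A : Set} (a? : Dec A) → A → ⟦ a? ⟧ ≡ 1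
⟦⟧-yes a? a = cong 𝟙 (dec-true a? a)

⟦⟧-no : ∀ {A : Set} (a? : Dec A) → ¬ A → ⟦ a? ⟧ ≡ 0
⟦⟧-no a? ¬a = cong 𝟙 (dec-false a? ¬a)

⟦×-dec⟧ʳ : ∀ {A B : Set} (a? : Dec A) (b? : Dec B) → B → ⟦ a? ×-dec b? ⟧ ≡ ⟦ a? ⟧
⟦×-dec⟧ʳ a? b? b = cong 𝟙 (trans (cong (does a? ∧_) (dec-true b? b)) (∧-identityʳ (does a?)))

⟦⟧*-yes : ∀ {A : Set} (a? : Dec A) → A → ∀ m → ⟦ a? ⟧ * m ≡ m
⟦⟧*-yes a? a m = trans (cong (_* m) (⟦⟧-yes a? a)) (+-identityʳ m)

⟦⟧*-no : ∀ {A : Set} (a? : Dec A) → ¬ A → ∀ m → ⟦ a? ⟧ * m ≡ 0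
⟦⟧*-no a? ¬a m = cong (_* m) (⟦⟧-no a? ¬a)

module _ {n : ℕ} where

  count : {P : Pred (Fin n) 0ℓ} → Decidable₁ P → ℕ
  count P? = sum λ i → ⟦ P? i ⟧

  module _ {P : Pred (Fin n) 0ℓ} (P? : Decidable₁ P) where

    count-none : (∀ i → ¬ P i) → count P? ≡ 0
    count-none ∄P = sum-zero (λ i → ⟦⟧-no (P? i) (∄P i))

    count-all : (∀ i → P i) → count P? ≡ n
    count-all ∀P = trans (sum-cong-≗ (λ i → ⟦⟧-yes (P? i) (∀P i))) (sum-one n)
      where
      sum-one : ∀ m → sum {m} (λ _ → 1) ≡ m
      sum-one zero    = refl
      sum-one (suc m) = cong suc (sum-one m)

  count-singleton : (v : Fin n) → count (_≟ v) ≡ 1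
  count-singleton v = trans (sum-support₁ _ v (λ j j≢v → ⟦⟧-no (j ≟ v) j≢v))
                            (⟦⟧-yes (v ≟ v) refl)

  module _ {P Q : Pred (Fin n) 0ℓ} (P? : Decidable₁ P) (Q? : Decidable₁ Q) where

    count-mono : P ⊆ Q → count P? ≤ count Q?
    count-mono P⊆Q = sum-mono-≤ pointwise
      where
      pointwise : ∀ i → ⟦ P? i ⟧ ≤ ⟦ Q? i ⟧
      pointwise i with P? i | Q? i
      ... | no _  | _     = z≤n
      ... | yes _ | yes _ = ≤-refl
      ... | yes p | no ¬q = contradiction (P⊆Q p) ¬q

    count-partition : {R : Pred (Fin n) 0ℓ} (R? : Decidable₁ R) →
                      (∀ {i} → R i ⇔ (P i ⊎ Q i)) → (∀ {i} → P i → ¬ Q i) →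
                      count R? ≡ count P? + count Q?
    count-partition R? R⇔P⊎Q disjoint =
      trans (sum-cong-≗ pointwise) (∑-distrib-+ (λ i → ⟦ P? i ⟧) (λ i → ⟦ Q? i ⟧))
      where
      pointwise : ∀ i → ⟦ R? i ⟧ ≡ ⟦ P? i ⟧ + ⟦ Q? i ⟧
      pointwise i with R? i | P? i | Q? i
      ... | _     | yes p | yes q = contradiction q (disjoint p)
      ... | yes _ | yes _ | no _  = refl
      ... | yes _ | no _  | yes _ = refl
      ... | yes r | no ¬p | no ¬q = ⊥-elim ([ ¬p , ¬q ]′ (Equivalence.to R⇔P⊎Q r))
      ... | no ¬r | yes p | no _  = contradiction (Equivalence.from R⇔P⊎Q (inj₁ p)) ¬r
      ... | no ¬r | no _  | yes q = contradiction (Equivalence.from R⇔P⊎Q (inj₂ q)) ¬r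
      ... | no _  | no _  | no _  = refl

  module _ {P : Pred (Fin n) 0ℓ} (P? : Decidable₁ P) where

    count-remove : ∀ {i} → P i → count P? ≡ suc (count λ j → P? j ×-dec ¬? (j ≟ i))
    count-remove {i} p = begin
      count P?                                             ≡⟨ count-partition At? Off? P? split disjoint ⟩
      count At? + count Off?                               ≡⟨ cong (_+ count Off?) at-i ⟩
      suc (count Off?)                                     ∎
      where
      open ≡-Reasoning
      At? Off? : Decidable₁ _
      At?  j = P? j ×-dec (j ≟ i)
      Off? j = P? j ×-dec ¬? (j ≟ i)
      split : ∀ {j} → P j ⇔ ((P j × j ≡ i) ⊎ (P j × j ≢ i))
      split {j} = mk⇔ (λ pj → Sum.map (pj ,_) (pj ,_) (toSum (j ≟ i))) [ proj₁ , proj₁ ]′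
      disjoint : ∀ {j} → P j × j ≡ i → ¬ (P j × j ≢ i)
      disjoint (_ , j≡i) (_ , j≢i) = j≢i j≡i
      at-i : count At? ≡ 1
      at-i = trans (sum-support₁ _ i (λ j j≢i → ⟦⟧-no (At? j) (j≢i ∘ proj₂)))
                   (⟦⟧-yes (At? i) (p , refl))

count-injection : ∀ {m n} {P : Pred (Fin m) 0ℓ} {Q : Pred (Fin n) 0ℓ}
                  (P? : Decidable₁ P) (Q? : Decidable₁ Q) (f : ∀ {i} → P i → Fin n) →
                  (∀ {i} (p : P i) → Q (f p)) →
                  (∀ {i j} (p : P i) (q : P j) → f p ≡ f q → i ≡ j) →
                  count P? ≤ count Q?
count-injection {zero}  P? Q? f Qf f-inj = z≤n
count-injection {suc m} P? Q? f Qf f-inj with P? zero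
... | no _  = count-injection (P? ∘ suc) Q? f Qf (λ p q → suc-injective ∘ f-inj p q)
... | yes p = subst (suc _ ≤_) (sym (count-remove Q? (Qf p)))
  (s≤s (count-injection (P? ∘ suc) (λ j → Q? j ×-dec ¬? (j ≟ f p)) f
    (λ q → Qf q , λ fq≡fp → 0≢1+n (f-inj p q (sym fq≡fp)))
    (λ p q → suc-injective ∘ f-inj p q)))

-- Arithmetic

m+n≡o⇒m≤o : ∀ m n {o} → m + n ≡ o → m ≤ o
m+n≡o⇒m≤o m n refl = m≤m+n m n

square-bound : ∀ {D C M} → D * D ≤ D + C → C < M * suc M → D ≤ M
square-bound {D} {C} {M} D²≤D+C C<M[M+1] = decidable-stable (D ≤? M) λ D≰M →
  <⇒≱ C<M[M+1] (+-cancelˡ-≤ D _ _ (≤-trans (D+M[M+1]≤D² (≰⇒> D≰M)) D²≤D+C))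
  where
  D+M[M+1]≤D² : M < D → D + M * suc M ≤ D * D
  D+M[M+1]≤D² M<D = begin
    D + M * suc M   ≡⟨ cong (D +_) (*-comm M (suc M)) ⟩
    D + suc M * M   ≤⟨ +-monoʳ-≤ D (*-monoˡ-≤ M M<D) ⟩
    D + D * M       ≡⟨ *-suc D M ⟨
    D * suc M       ≤⟨ *-monoʳ-≤ D M<D ⟩
    D * D           ∎
    where open ≤-Reasoning

-- The vertex equations of a vertex u outside all triangles, of a vertex a of a triangle a b c with the
-- same plain degree B as u, and of b.
outside-bound : ∀ N B βb βc Qu Qa Qb K →
  2 * N ≡ 2 + B * suc B + 2 * Qu →
  2 * N ≡ 2 + B * suc B + 2 * (2 + (βb + βc) + Qa) →
  2 * N ≡ 2 + βb * suc βb + 2 * (2 + (B + βc) + Qb) →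
  Qu ≤ 2 * K → Qb ≤ 2 * K →
  2 * N ≤ 2 + suc (2 * K) * suc (suc (2 * K)) + 2 * (2 * K)
outside-bound N B βb βc Qu Qa Qb K eq-u eq-a eq-b Qu≤2K Qb≤2K = begin
  2 * N                              ≡⟨ eq-u ⟩
  2 + B * suc B + 2 * Qu             ≤⟨ +-mono-≤ (+-monoʳ-≤ 2 (*-mono-≤ B≤M (s≤s B≤M))) (*-monoʳ-≤ 2 Qu≤2K) ⟩
  2 + M * suc M + 2 * (2 * K)        ∎
  where
  open ≤-Reasoning
  M : ℕ
  M = suc (2 * K)

  regroupᵃ : ∀ B βb βc Qa → 2 + B * suc B + 2 * (2 + (βb + βc) + Qa) ≡
                            (6 + B + 2 * βc) + (B * B + 2 * βb + 2 * Qa)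
  regroupᵃ = solve-∀
  regroupᵇ : ∀ B βb βc Qb → 2 + βb * suc βb + 2 * (2 + (B + βc) + Qb) ≡
                            (6 + B + 2 * βc) + (βb * suc βb + B + 2 * Qb)
  regroupᵇ = solve-∀
  regroupᶜ : ∀ B βb Qb → βb * suc βb + B + 2 * Qb ≡ B + (βb * suc βb + 2 * Qb)
  regroupᶜ = solve-∀
  square-gap : ∀ K → 2 * K * suc (2 * K) + 2 * (2 * K) + 2 ≡ suc (2 * K) * suc (suc (2 * K))
  square-gap = solve-∀
  shift : ∀ βb βc Qa → βb + (2 + βc + Qa) ≡ 2 + (βb + βc) + Qa
  shift = solve-∀

  Qu≡ : Qu ≡ 2 + (βb + βc) + Qa
  Qu≡ = *-cancelˡ-≡ Qu _ 2 (+-cancelˡ-≡ (2 + B * suc B) _ _ (trans (sym eq-u) eq-a))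

  βb≤2K : βb ≤ 2 * K
  βb≤2K = ≤-trans (m+n≡o⇒m≤o βb (2 + βc + Qa) (trans (shift βb βc Qa) (sym Qu≡))) Qu≤2K

  B²≤ : B * B ≤ B + (βb * suc βb + 2 * Qb)
  B²≤ = begin
    B * B                           ≤⟨ m≤m+n (B * B) (2 * βb + 2 * Qa) ⟩
    B * B + (2 * βb + 2 * Qa)       ≡⟨ +-assoc (B * B) _ _ ⟨
    B * B + 2 * βb + 2 * Qa         ≡⟨ +-cancelˡ-≡ (6 + B + 2 * βc) _ _ (trans (sym (regroupᵃ B βb βc Qa))
                                          (trans (sym eq-a) (trans eq-b (regroupᵇ B βb βc Qb)))) ⟩
    βb * suc βb + B + 2 * Qb        ≡⟨ regroupᶜ B βb Qb ⟩
    B + (βb * suc βb + 2 * Qb)      ∎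

  B≤M : B ≤ M
  B≤M = square-bound B²≤ (begin-strict
    βb * suc βb + 2 * Qb                    ≤⟨ +-mono-≤ (*-mono-≤ βb≤2K (s≤s βb≤2K)) (*-monoʳ-≤ 2 Qb≤2K) ⟩
    2 * K * suc (2 * K) + 2 * (2 * K)       <⟨ m<m+n _ (s≤s z≤n) ⟩
    2 * K * suc (2 * K) + 2 * (2 * K) + 2   ≡⟨ square-gap K ⟩
    M * suc M                               ∎)

order-too-small : ∀ {k n} → 2 ≤ k → 18 * k ^ 2 ∸ 24 * k + 10 < n → ¬ (2 * n ≤ 4 * k * k + 10 * k + 6)
order-too-small {suc (suc j)} {n} (s≤s (s≤s z≤n)) n-large 2n≤ =
  <⇒≱ gap (≤-trans (*-monoʳ-≤ 2 n≥) 2n≤)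
  where
  -- (2 + j) ^ 2 unfolds to (2 + j) * ((2 + j) * 1); the ring solver does not accept _^_.
  excess : ∀ j → 18 * ((2 + j) * ((2 + j) * 1)) ≡ 24 * (2 + j) + (18 * (j * j) + 48 * j + 24)
  excess = solve-∀
  gap-identity : ∀ j → suc (4 * (2 + j) * (2 + j) + 10 * (2 + j) + 6) + (32 * (j * j) + 70 * j + 27)
                       ≡ 2 * (18 * (j * j) + 48 * j + 35)
  gap-identity = solve-∀
  tail-identity : ∀ j → suc (18 * (j * j) + 48 * j + 24 + 10) ≡ 18 * (j * j) + 48 * j + 35
  tail-identity = solve-∀
  n≥ : 18 * (j * j) + 48 * j + 35 ≤ n
  n≥ = subst (_≤ n) (tail-identity j) (subst (λ m → m + 10 < n) bound-value n-large)
    where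
    bound-value : 18 * (2 + j) ^ 2 ∸ 24 * (2 + j) ≡ 18 * (j * j) + 48 * j + 24
    bound-value = trans (cong (_∸ 24 * (2 + j)) (excess j)) (m+n∸m≡n (24 * (2 + j)) _)
  gap : 4 * (2 + j) * (2 + j) + 10 * (2 + j) + 6 < 2 * (18 * (j * j) + 48 * j + 35)
  gap = m+n≡o⇒m≤o _ _ (gap-identity j)

-- Graphs, triangles and diamonds

SamePair : ∀ {n} → Fin n → Fin n → Fin n → Fin n → Set
SamePair a b a′ b′ = (a ≡ a′ × b ≡ b′) ⊎ (a ≡ b′ × b ≡ a′)

samePair-trans : ∀ {n} {x y a b a′ b′ : Fin n} →
                 SamePair x y a b → SamePair x y a′ b′ → SamePair a b a′ b′
samePair-trans (inj₁ (refl , refl)) (inj₁ (refl , refl)) = inj₁ (refl , refl)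
samePair-trans (inj₁ (refl , refl)) (inj₂ (refl , refl)) = inj₂ (refl , refl)
samePair-trans (inj₂ (refl , refl)) (inj₁ (refl , refl)) = inj₂ (refl , refl)
samePair-trans (inj₂ (refl , refl)) (inj₂ (refl , refl)) = inj₁ (refl , refl)

<ᵇ-complete : ∀ {n} {a b : Fin n} → a <ᶠ b → (a <ᵇ b) ≡ true
<ᵇ-complete {a = a} {b} a<b = trans (isYes≗does (a <? b)) (dec-true (a <? b) a<b)

≠ᵇ-complete : ∀ {n} {a b : Fin n} → a ≢ b → (a ≠ᵇ b) ≡ true
≠ᵇ-complete {a = a} {b} a≢b = cong not (trans (isYes≗does (a ≟ b)) (dec-false (a ≟ b) a≢b))

module Adjacency {n : ℕ} (G : Graph n) where

  infix 4 _~_ _~?_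

  _~_ : Fin n → Fin n → Set
  x ~ y = T (adj G x y)

  _~?_ : Decidable _~_
  x ~? y = T? (adj G x y)

  ~⇒≡true : ∀ {x y} → x ~ y → adj G x y ≡ true
  ~⇒≡true = Equivalence.to T-≡

  ≡true⇒~ : ∀ {x y} → adj G x y ≡ true → x ~ y
  ≡true⇒~ = Equivalence.from T-≡

  ~-sym : ∀ {x y} → x ~ y → y ~ x
  ~-sym {x} {y} = subst T (Graph.sym G x y)

  ~⇒≢ : ∀ {x y} → x ~ y → x ≢ y
  ~⇒≢ {x} x~x refl = subst T (irrefl G x) x~x

  Triangle : Fin n → Fin n → Fin n → Set
  Triangle x y z = x ~ y × x ~ z × y ~ z

  CommonNeighbour : Fin n → Fin n → Fin n → Set
  CommonNeighbour x y t = x ~ t × y ~ t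

  TriangleEdge PlainEdge : Fin n → Fin n → Set
  TriangleEdge x y = x ~ y × ∃ (CommonNeighbour x y)
  PlainEdge    x y = x ~ y × ¬ ∃ (CommonNeighbour x y)

  InTriangle : Fin n → Set
  InTriangle v = ∃₂ (Triangle v)

  CommonNeighbour? : ∀ x y → Decidable₁ (CommonNeighbour x y)
  CommonNeighbour? x y t = x ~? t ×-dec y ~? t

  TriangleEdge? : Decidable TriangleEdge
  TriangleEdge? x y = x ~? y ×-dec any? (CommonNeighbour? x y)

  PlainEdge? : Decidable PlainEdge
  PlainEdge? x y = x ~? y ×-dec ¬? (any? (CommonNeighbour? x y))

  InTriangle? : Decidable₁ InTriangle
  InTriangle? v = any? λ b → any? λ c → v ~? b ×-dec v ~? c ×-dec b ~? c

  edge-kind : ∀ {x y} → x ~ y → TriangleEdge x y ⊎ PlainEdge x y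
  edge-kind {x} {y} x~y = Sum.map (x~y ,_) (x~y ,_) (toSum (any? (CommonNeighbour? x y)))

  neighbour-kind : ∀ x y → ¬ x ~ y ⊎ TriangleEdge x y ⊎ PlainEdge x y
  neighbour-kind x y = Sum.map₂ edge-kind (Sum.swap (toSum (x ~? y)))

  triangle⇒¬plain : ∀ {x y} → TriangleEdge x y → ¬ PlainEdge x y
  triangle⇒¬plain (_ , t) (_ , ∄t) = ∄t t

  triangleEdge-sym : ∀ {x y} → TriangleEdge x y → TriangleEdge y x
  triangleEdge-sym (x~y , t , x~t , y~t) = ~-sym x~y , t , y~t , x~t

  plainEdge-sym : ∀ {x y} → PlainEdge x y → PlainEdge y x
  plainEdge-sym (x~y , ∄t) = ~-sym x~y , λ (t , y~t , x~t) → ∄t (t , x~t , y~t)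

  triangleEdge⇒inTriangle : ∀ {v w} → TriangleEdge v w → InTriangle v
  triangleEdge⇒inTriangle (v~w , t , v~t , w~t) = _ , _ , v~w , v~t , w~t

  plain-neighbours-nonadjacent : ∀ {v y₁ y₂} → PlainEdge v y₁ → PlainEdge v y₂ → ¬ y₁ ~ y₂
  plain-neighbours-nonadjacent (_ , ∄) (v~y₂ , _) y₁~y₂ = ∄ (_ , v~y₂ , y₁~y₂)

  NonNeighbour : Fin n → Fin n → Set
  NonNeighbour v w = w ≢ v × ¬ v ~ w

  NonNeighbour? : Decidable NonNeighbour
  NonNeighbour? v w = ¬? (w ≟ v) ×-dec ¬? (v ~? w)

  plainDeg triDeg nonDeg : Fin n → ℕ
  plainDeg v = count (PlainEdge? v)
  triDeg   v = count (TriangleEdge? v)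
  nonDeg   v = count (NonNeighbour? v)

  vertex-partition : ∀ v → n ≡ suc (plainDeg v + triDeg v + nonDeg v)
  vertex-partition v = begin
    n                                      ≡⟨ count-all Any? (λ _ → tt) ⟨
    count Any?                             ≡⟨ count-partition Self? Other? Any? self-or-other
                                                                (λ refl w≢v → w≢v refl) ⟩
    count Self? + count Other?             ≡⟨ cong₂ _+_ (count-singleton v)
                                                 (count-partition (v ~?_) (NonNeighbour? v) Other?
                                                                  nbr-or-non disjoint) ⟩
    suc (count (v ~?_) + nonDeg v)         ≡⟨ cong (λ d → suc (d + nonDeg v))
                                                 (count-partition (PlainEdge? v) (TriangleEdge? v) (v ~?_)
                                                                  plain-or-triangle (flip triangle⇒¬plain)) ⟩
    suc (plainDeg v + triDeg v + nonDeg v) ∎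
    where
    open ≡-Reasoning
    Any? Self? Other? : Decidable₁ _
    Any?   _ = yes tt
    Self?  w = w ≟ v
    Other? w = ¬? (w ≟ v)
    self-or-other : ∀ {w} → ⊤ ⇔ (w ≡ v ⊎ w ≢ v)
    self-or-other {w} = mk⇔ (λ _ → toSum (w ≟ v)) (λ _ → tt)
    nbr-or-non : ∀ {w} → w ≢ v ⇔ (v ~ w ⊎ NonNeighbour v w)
    nbr-or-non {w} = mk⇔ (λ w≢v → Sum.map₂ (w≢v ,_) (toSum (v ~? w))) [ ≢-sym ∘ ~⇒≢ , proj₁ ]′
    disjoint : ∀ {w} → v ~ w → ¬ NonNeighbour v w
    disjoint v~w (_ , v≁w) = v≁w v~w
    plain-or-triangle : ∀ {w} → v ~ w ⇔ (PlainEdge v w ⊎ TriangleEdge v w)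
    plain-or-triangle = mk⇔ (Sum.swap ∘ edge-kind) [ proj₁ , proj₁ ]′

  triangle-swapˡ : ∀ {a b c} → Triangle a b c → Triangle b a c
  triangle-swapˡ (a~b , a~c , b~c) = ~-sym a~b , b~c , a~c

  triangle-swapʳ : ∀ {a b c} → Triangle a b c → Triangle a c b
  triangle-swapʳ (a~b , a~c , b~c) = a~c , a~b , ~-sym b~c

  orderedTriangleᵇ : Fin n → Fin n → Fin n → Bool
  orderedTriangleᵇ a b c = (a <ᵇ b) ∧ (b <ᵇ c) ∧ adj G a b ∧ adj G a c ∧ adj G b c

  trianglesFrom : Fin n → ℕ
  trianglesFrom a = ∑∑ λ b c → 𝟙 (orderedTriangleᵇ a b c)

  triangles≡sum : triangles (adj G) ≡ sum trianglesFrom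
  triangles≡sum = trans (sumFin≡sum {n} _) (sum-cong-≗ {n} λ a →
                  trans (sumFin≡sum {n} _) (sum-cong-≗ {n} λ b →
                  sumFin≡sum {n} _))

  ordered⇒trianglesFrom-pos : ∀ {a b c} → a <ᶠ b → b <ᶠ c → Triangle a b c → 0 < trianglesFrom a
  ordered⇒trianglesFrom-pos {a} {b} {c} a<b b<c (a~b , a~c , b~c) =
    ≤-trans (𝟙-pos ordered) (term≤∑∑ (λ b c → 𝟙 (orderedTriangleᵇ a b c)) b c)
    where
    ordered : T (orderedTriangleᵇ a b c)
    ordered rewrite <ᵇ-complete a<b | <ᵇ-complete b<c
                  | ~⇒≡true a~b | ~⇒≡true a~c | ~⇒≡true b~c = _

  trianglesFrom-pos⇒triangle : ∀ {a} → 0 < trianglesFrom a → InTriangle a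
  trianglesFrom-pos⇒triangle {a} pos with b , c , pos′ ← ∑∑-pos (λ b c → 𝟙 (orderedTriangleᵇ a b c)) pos =
    b , c , triangle (𝟙-pos⁻¹ pos′)
    where
    triangle : ∀ {b c} → T (orderedTriangleᵇ a b c) → Triangle a b c
    triangle {b} {c} _ with a <ᵇ b | b <ᵇ c | adj G a b | adj G a c | adj G b c
    ... | true | true | true | true | true = _

  triangles-pos⇒triangle : 0 < triangles (adj G) → ∃ InTriangle
  triangles-pos⇒triangle pos with a , pos′ ← sum-pos trianglesFrom (subst (0 <_) triangles≡sum pos) =
    a , trianglesFrom-pos⇒triangle pos′

  private
    least-of-three : ∀ {a b c} → a <ᶠ b → a <ᶠ c → Triangle a b c → 0 < trianglesFrom a
    least-of-three {b = b} {c} a<b a<c abc with <-cmp b c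
    ... | tri< b<c _ _ = ordered⇒trianglesFrom-pos a<b b<c abc
    ... | tri≈ _ b≡c _ = contradiction b≡c (~⇒≢ (proj₂ (proj₂ abc)))
    ... | tri> _ _ c<b = ordered⇒trianglesFrom-pos a<c c<b (triangle-swapʳ abc)

  least-vertex : ∀ {x y z} → Triangle x y z → ∃[ r ] (r ≡ x ⊎ r ≡ y ⊎ r ≡ z) × 0 < trianglesFrom r
  least-vertex {x} {y} {z} xyz@(x~y , x~z , y~z) with <-cmp x y
  ... | tri≈ _ x≡y _ = contradiction x≡y (~⇒≢ x~y)
  ... | tri< x<y _ _ with <-cmp x z
  ...   | tri< x<z _ _ = x , inj₁ refl , least-of-three x<y x<z xyz
  ...   | tri≈ _ x≡z _ = contradiction x≡z (~⇒≢ x~z)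
  ...   | tri> _ _ z<x = z , inj₂ (inj₂ refl) ,
                         least-of-three z<x (<-trans z<x x<y) (triangle-swapˡ (triangle-swapʳ xyz))
  least-vertex {x} {y} {z} xyz@(x~y , x~z , y~z) | tri> _ _ y<x with <-cmp y z
  ...   | tri< y<z _ _ = y , inj₂ (inj₁ refl) , least-of-three y<x y<z (triangle-swapˡ xyz)
  ...   | tri≈ _ y≡z _ = contradiction y≡z (~⇒≢ y~z)
  ...   | tri> _ _ z<y = z , inj₂ (inj₂ refl) ,
                         least-of-three z<y (<-trans z<y y<x)
                                        (triangle-swapʳ (triangle-swapˡ (triangle-swapʳ xyz)))

  record Diamond (a b c d : Fin n) : Set where
    constructor diamond
    field
      a~b : a ~ b
      a~c : a ~ c
      b~c : b ~ c
      a~d : a ~ d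
      b~d : b ~ d
      c≢d : c ≢ d

  swap-chord : ∀ {a b c d} → Diamond a b c d → Diamond b a c d
  swap-chord (diamond a~b a~c b~c a~d b~d c≢d) = diamond (~-sym a~b) b~c a~c b~d a~d c≢d

  swap-tips : ∀ {a b c d} → Diamond a b c d → Diamond a b d c
  swap-tips (diamond a~b a~c b~c a~d b~d c≢d) = diamond a~b a~d b~d a~c b~c (c≢d ∘ sym)

  orderedDiamondᵇ : Fin n → Fin n → Fin n → Fin n → Bool
  orderedDiamondᵇ a b c d =
    (a <ᵇ b) ∧ (c <ᵇ d) ∧ (a ≠ᵇ c) ∧ (a ≠ᵇ d) ∧ (b ≠ᵇ c) ∧ (b ≠ᵇ d)
    ∧ adj G a b ∧ adj G a c ∧ adj G b c ∧ adj G a d ∧ adj G b d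

  diamonds≡∑∑ : diamonds (adj G) ≡ ∑∑ λ a b → ∑∑ λ c d → 𝟙 (orderedDiamondᵇ a b c d)
  diamonds≡∑∑ = trans (sumFin≡sum {n} _) (sum-cong-≗ {n} λ a →
                trans (sumFin≡sum {n} _) (sum-cong-≗ {n} λ b →
                trans (sumFin≡sum {n} _) (sum-cong-≗ {n} λ c →
                sumFin≡sum {n} _)))

  orderedDiamondᵇ-complete : ∀ {a b c d} → a <ᶠ b → c <ᶠ d → Diamond a b c d →
                             T (orderedDiamondᵇ a b c d)
  orderedDiamondᵇ-complete a<b c<d (diamond a~b a~c b~c a~d b~d _)
    rewrite <ᵇ-complete a<b | <ᵇ-complete c<d
          | ≠ᵇ-complete (~⇒≢ a~c) | ≠ᵇ-complete (~⇒≢ a~d)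
          | ≠ᵇ-complete (~⇒≢ b~c) | ≠ᵇ-complete (~⇒≢ b~d)
          | ~⇒≡true a~b | ~⇒≡true a~c | ~⇒≡true b~c | ~⇒≡true a~d | ~⇒≡true b~d = _

  orderedDiamondᵇ-sound : ∀ {a b c d} → T (orderedDiamondᵇ a b c d) → Diamond a b c d
  orderedDiamondᵇ-sound {a} {b} {c} {d} _
    with a <ᵇ b | c <? d | a ≠ᵇ c | a ≠ᵇ d | b ≠ᵇ c | b ≠ᵇ d
       | adj G a b in a~b | adj G a c in a~c | adj G b c in b~c | adj G a d in a~d | adj G b d in b~d
  ... | true | yes c<d | true | true | true | true | true | true | true | true | true =
    diamond (≡true⇒~ a~b) (≡true⇒~ a~c) (≡true⇒~ b~c) (≡true⇒~ a~d) (≡true⇒~ b~d) (<⇒≢ c<d)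

  sort-diamond : ∀ {a b c d} → Diamond a b c d →
                 ∃[ a′ ] ∃[ b′ ] ∃[ c′ ] ∃[ d′ ]
                   T (orderedDiamondᵇ a′ b′ c′ d′) × SamePair a′ b′ a b × SamePair c′ d′ c d
  sort-diamond {a} {b} {c} {d} D with <-cmp a b | <-cmp c d
  ... | tri≈ _ a≡b _ | _ = contradiction a≡b (~⇒≢ (Diamond.a~b D))
  ... | _ | tri≈ _ c≡d _ = contradiction c≡d (Diamond.c≢d D)
  ... | tri< a<b _ _ | tri< c<d _ _ =
    a , b , c , d , orderedDiamondᵇ-complete a<b c<d D , inj₁ (refl , refl) , inj₁ (refl , refl)
  ... | tri> _ _ b<a | tri< c<d _ _ =
    b , a , c , d , orderedDiamondᵇ-complete b<a c<d (swap-chord D) , inj₂ (refl , refl) , inj₁ (refl , refl)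
  ... | tri< a<b _ _ | tri> _ _ d<c =
    a , b , d , c , orderedDiamondᵇ-complete a<b d<c (swap-tips D) , inj₁ (refl , refl) , inj₂ (refl , refl)
  ... | tri> _ _ b<a | tri> _ _ d<c =
    b , a , d , c , orderedDiamondᵇ-complete b<a d<c (swap-chord (swap-tips D)) ,
    inj₂ (refl , refl) , inj₂ (refl , refl)

  private
    ordered : Fin n → Fin n → Fin n → Fin n → ℕ
    ordered a b c d = 𝟙 (orderedDiamondᵇ a b c d)

  diamond⇒diamonds-pos : ∀ {a b c d} → Diamond a b c d → 0 < diamonds (adj G)
  diamond⇒diamonds-pos D with a , b , c , d , isOrdered , _ ← sort-diamond D =
    subst (0 <_) (sym diamonds≡∑∑) (≤-trans (𝟙-pos isOrdered)
      (≤-trans (term≤∑∑ (ordered a b) c d) (term≤∑∑ (λ a b → ∑∑ (ordered a b)) a b)))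

  diamonds-pos⇒diamond : 0 < diamonds (adj G) → ∃[ a ] ∃[ b ] ∃[ c ] ∃[ d ] Diamond a b c d
  diamonds-pos⇒diamond pos
    with a , b , pos′ ← ∑∑-pos (λ a b → ∑∑ (ordered a b)) (subst (0 <_) diamonds≡∑∑ pos)
    with c , d , pos″ ← ∑∑-pos (ordered a b) pos′ = a , b , c , d , orderedDiamondᵇ-sound (𝟙-pos⁻¹ pos″)

  diamonds≤1⇒unique : diamonds (adj G) ≤ 1 → ∀ {a b c d a′ b′ c′ d′} →
                      Diamond a b c d → Diamond a′ b′ c′ d′ → SamePair a b a′ b′ × SamePair c d c′ d′
  diamonds≤1⇒unique ≤1 D D′
    with a , b , c , d , isOrdered , ab , cd ← sort-diamond D
       | a′ , b′ , c′ , d′ , isOrdered′ , ab′ , cd′ ← sort-diamond D′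
    with refl , refl ← ∑∑≤1-unique (λ a b → ∑∑ (ordered a b)) {a} {a′} {b} {b′} (subst (_≤ 1) diamonds≡∑∑ ≤1)
                         (≤-trans (𝟙-pos isOrdered) (term≤∑∑ (ordered a b) c d))
                         (≤-trans (𝟙-pos isOrdered′) (term≤∑∑ (ordered a′ b′) c′ d′))
    with refl , refl ← ∑∑≤1-unique (ordered a b) {c} {c′} {d} {d′}
                         (≤-trans (term≤∑∑ (λ a b → ∑∑ (ordered a b)) a b) (subst (_≤ 1) diamonds≡∑∑ ≤1))
                         (𝟙-pos isOrdered) (𝟙-pos isOrdered′)
    = samePair-trans ab ab′ , samePair-trans cd cd′

-- Adding an edge

withEdge : ∀ {n} (G : Graph n) {u v : Fin n} → u ≢ v → Graph n
withEdge G {u} {v} u≢v = record { adj = addEdge (adj G) u v ; sym = sym⁺ ; irrefl = irrefl⁺ }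
  where
  sym⁺ : ∀ i j → addEdge (adj G) u v i j ≡ addEdge (adj G) u v j i
  sym⁺ i j = cong₂ _∨_ (Graph.sym G i j)
    (trans (∨-comm (⌊ i ≟ u ⌋ ∧ ⌊ j ≟ v ⌋) _) (cong₂ _∨_ (∧-comm ⌊ i ≟ v ⌋ _) (∧-comm ⌊ i ≟ u ⌋ _)))
  irrefl⁺ : ∀ i → addEdge (adj G) u v i i ≡ false
  irrefl⁺ i rewrite irrefl G i with i ≟ u | i ≟ v
  ... | yes i≡u | yes i≡v = contradiction (trans (sym i≡u) i≡v) u≢v
  ... | yes _   | no _    = refl
  ... | no _    | yes _   = refl
  ... | no _    | no _    = refl

module EdgeAddition {n : ℕ} (G : Graph n) {u v : Fin n} (u≢v : u ≢ v) where

  open Adjacency G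
  open Adjacency (withEdge G u≢v) public
    using () renaming (_~_ to _~⁺_; ~-sym to ~⁺-sym; ~⇒≢ to ~⁺⇒≢; Diamond to Diamond⁺;
                       diamond to diamond⁺; swap-chord to swap-chord⁺; swap-tips to swap-tips⁺)

  ~⇒~⁺ : ∀ {x y} → x ~ y → x ~⁺ y
  ~⇒~⁺ x~y = Equivalence.from T-∨ (inj₁ x~y)

  u~⁺v : u ~⁺ v
  u~⁺v = Equivalence.from T-≡
    (trans (cong (λ b → adj G u v ∨ (b ∨ (⌊ u ≟ v ⌋ ∧ ⌊ v ≟ u ⌋))) (cong₂ _∧_ (≟-refl u) (≟-refl v)))
           (∨-zeroʳ (adj G u v)))
    where
    ≟-refl : ∀ i → ⌊ i ≟ i ⌋ ≡ true
    ≟-refl i = trans (isYes≗does (i ≟ i)) (dec-true (i ≟ i) refl)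

  ~⁺-cases : ∀ {x y} → x ~⁺ y → x ~ y ⊎ SamePair x y u v
  ~⁺-cases x~⁺y = Sum.map₂ new (Equivalence.to T-∨ x~⁺y)
    where
    both : ∀ {a b c d : Fin n} → T (⌊ a ≟ c ⌋ ∧ ⌊ b ≟ d ⌋) → a ≡ c × b ≡ d
    both {a} {b} {c} {d} h =
      Product.map toWitness toWitness (Equivalence.to (T-∧ {⌊ a ≟ c ⌋} {⌊ b ≟ d ⌋}) h)
    new : ∀ {x y} → T ((⌊ x ≟ u ⌋ ∧ ⌊ y ≟ v ⌋) ∨ (⌊ x ≟ v ⌋ ∧ ⌊ y ≟ u ⌋)) → SamePair x y u v
    new {x} {y} h = Sum.map both both (Equivalence.to (T-∨ {⌊ x ≟ u ⌋ ∧ ⌊ y ≟ v ⌋}) h)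

  ~⁺⇒~ : ∀ {x y} → x ~⁺ y → y ≢ u → y ≢ v → x ~ y
  ~⁺⇒~ x~⁺y y≢u y≢v with ~⁺-cases x~⁺y
  ... | inj₁ x~y = x~y
  ... | inj₂ (inj₁ (_ , y≡v)) = contradiction y≡v y≢v
  ... | inj₂ (inj₂ (_ , y≡u)) = contradiction y≡u y≢u

  ~⁺⇒~-at-common⁺ : ∀ {x y} → x ~⁺ y → u ~⁺ y → v ~⁺ y → x ~ y
  ~⁺⇒~-at-common⁺ x~⁺y u~⁺y v~⁺y = ~⁺⇒~ x~⁺y (≢-sym (~⁺⇒≢ u~⁺y)) (≢-sym (~⁺⇒≢ v~⁺y))

-- Uniquely diamond-saturated graphs

module UniquelySaturated {n : ℕ} (G : Graph n) (sat : UniquelyDiamondSaturated G) where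

  open Adjacency G

  no-diamond : ∀ {a b c d} → ¬ Diamond a b c d
  no-diamond D with () ← subst (0 <_) (proj₁ sat) (diamond⇒diamonds-pos D)

  triangle-edge-unique : ∀ {x y t s} → x ~ y → CommonNeighbour x y t → CommonNeighbour x y s → t ≡ s
  triangle-edge-unique {t = t} {s} x~y (x~t , y~t) (x~s , y~s) =
    decidable-stable (t ≟ s) λ t≢s → no-diamond (diamond x~y x~t y~t x~s y~s t≢s)

  -- The possible shapes of the unique diamond of G + uv: uv is its chord, or a side whose chord is u x or v x.
  data Completion (u v : Fin n) : Set where
    chord : ∀ {c d} → c ≢ d → CommonNeighbour u v c → CommonNeighbour u v d → Completion u v
    sideᵘ : ∀ {x t} → CommonNeighbour u v x → CommonNeighbour u x t → Completion u v
    sideᵛ : ∀ {x t} → CommonNeighbour u v x → CommonNeighbour v x t → Completion u v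

  module NonEdge {u v : Fin n} (u≢v : u ≢ v) (u≁v : ¬ u ~ v) where

    open EdgeAddition G u≢v

    private
      chord-completion : ∀ {a b c d} → Diamond⁺ a b c d → SamePair a b u v → Completion u v
      chord-completion (diamond⁺ a~b a~c b~c a~d b~d c≢d) (inj₁ (refl , refl)) =
        chord c≢d (~⁺⇒~-at-common⁺ a~c a~c b~c , ~⁺⇒~-at-common⁺ b~c a~c b~c)
                  (~⁺⇒~-at-common⁺ a~d a~d b~d , ~⁺⇒~-at-common⁺ b~d a~d b~d)
      chord-completion (diamond⁺ a~b a~c b~c a~d b~d c≢d) (inj₂ (refl , refl)) =
        chord c≢d (~⁺⇒~-at-common⁺ b~c b~c a~c , ~⁺⇒~-at-common⁺ a~c b~c a~c)
                  (~⁺⇒~-at-common⁺ b~d b~d a~d , ~⁺⇒~-at-common⁺ a~d b~d a~d)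

      side-completion : ∀ {a b c d} → Diamond⁺ a b c d → SamePair a c u v → Completion u v
      side-completion (diamond⁺ a~b a~c b~c a~d b~d c≢d) (inj₁ (refl , refl)) =
        sideᵘ (~⁺⇒~-at-common⁺ a~b a~b (~⁺-sym b~c) , ~⁺⇒~-at-common⁺ (~⁺-sym b~c) a~b (~⁺-sym b~c))
              (~⁺⇒~ a~d (≢-sym (~⁺⇒≢ a~d)) (≢-sym c≢d) ,
               ~-sym (~⁺⇒~-at-common⁺ (~⁺-sym b~d) a~b (~⁺-sym b~c)))
      side-completion (diamond⁺ a~b a~c b~c a~d b~d c≢d) (inj₂ (refl , refl)) =
        sideᵛ (~⁺⇒~-at-common⁺ (~⁺-sym b~c) (~⁺-sym b~c) a~b , ~⁺⇒~-at-common⁺ a~b (~⁺-sym b~c) a~b)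
              (~⁺⇒~ a~d (≢-sym c≢d) (≢-sym (~⁺⇒≢ a~d)) ,
               ~-sym (~⁺⇒~-at-common⁺ (~⁺-sym b~d) (~⁺-sym b~c) a~b))

      completion-of : ∀ {a b c d} → Diamond⁺ a b c d → Completion u v
      completion-of D@(diamond⁺ a~b a~c b~c a~d b~d c≢d) with ~⁺-cases a~b
      ... | inj₂ ab≐uv = chord-completion D ab≐uv
      ... | inj₁ a~b′ with ~⁺-cases a~c
      ...   | inj₂ ac≐uv = side-completion D ac≐uv
      ...   | inj₁ a~c′ with ~⁺-cases b~c
      ...     | inj₂ bc≐uv = side-completion (swap-chord⁺ D) bc≐uv
      ...     | inj₁ b~c′ with ~⁺-cases a~d
      ...       | inj₂ ad≐uv = side-completion (swap-tips⁺ D) ad≐uv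
      ...       | inj₁ a~d′ with ~⁺-cases b~d
      ...         | inj₂ bd≐uv = side-completion (swap-chord⁺ (swap-tips⁺ D)) bd≐uv
      ...         | inj₁ b~d′ = contradiction (diamond a~b′ a~c′ b~c′ a~d′ b~d′ c≢d) no-diamond

      diamonds⁺≡1 : diamonds (adj (withEdge G u≢v)) ≡ 1
      diamonds⁺≡1 = proj₂ sat u v u≢v (dec-false (u ~? v) u≁v)

    completion : Completion u v
    completion = completion-of (proj₂ (proj₂ (proj₂ (proj₂ diamond⁺-exists))))
      where
      diamond⁺-exists : ∃[ a ] ∃[ b ] ∃[ c ] ∃[ d ] Diamond⁺ a b c d
      diamond⁺-exists = Adjacency.diamonds-pos⇒diamond (withEdge G u≢v) (≤-reflexive (sym diamonds⁺≡1))

    private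
      unique⁺ : ∀ {a b c d a′ b′ c′ d′} → Diamond⁺ a b c d → Diamond⁺ a′ b′ c′ d′ →
                SamePair a b a′ b′ × SamePair c d c′ d′
      unique⁺ = Adjacency.diamonds≤1⇒unique (withEdge G u≢v) (≤-reflexive diamonds⁺≡1)

      chord-diamond : ∀ {c d} → c ≢ d → CommonNeighbour u v c → CommonNeighbour u v d → Diamond⁺ u v c d
      chord-diamond c≢d (u~c , v~c) (u~d , v~d) =
        diamond⁺ u~⁺v (~⇒~⁺ u~c) (~⇒~⁺ v~c) (~⇒~⁺ u~d) (~⇒~⁺ v~d) c≢d

      sideᵘ-diamond : ∀ {x t} → CommonNeighbour u v x → CommonNeighbour u x t → Diamond⁺ u x t v
      sideᵘ-diamond (u~x , v~x) (u~t , x~t) =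
        diamond⁺ (~⇒~⁺ u~x) (~⇒~⁺ u~t) (~⇒~⁺ x~t) u~⁺v (~⇒~⁺ (~-sym v~x))
                 (λ { refl → u≁v u~t })

      sideᵛ-diamond : ∀ {x t} → CommonNeighbour u v x → CommonNeighbour v x t → Diamond⁺ v x t u
      sideᵛ-diamond (u~x , v~x) (v~t , x~t) =
        diamond⁺ (~⇒~⁺ v~x) (~⇒~⁺ v~t) (~⇒~⁺ x~t) (~⁺-sym u~⁺v) (~⇒~⁺ (~-sym u~x))
                 (λ { refl → u≁v (~-sym v~t) })

    at-most-two-common-neighbours : ∀ {x y z} →
      CommonNeighbour u v x → CommonNeighbour u v y → CommonNeighbour u v z →
      x ≢ y → x ≢ z → y ≢ z → ⊥
    at-most-two-common-neighbours cx cy cz x≢y x≢z y≢z =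
      [ y≢z ∘ proj₂ , x≢z ∘ proj₁ ]′ (proj₂ (unique⁺ (chord-diamond x≢y cx cy) (chord-diamond x≢z cx cz)))

    two-common⇒no-triangleᵘ : ∀ {x y t} → CommonNeighbour u v x → CommonNeighbour u v y → x ≢ y →
                              ¬ CommonNeighbour u x t
    two-common⇒no-triangleᵘ cx cy x≢y ct =
      [ ~⇒≢ (proj₂ cx) ∘ sym ∘ proj₂ , u≢v ∘ proj₁ ]′
        (proj₁ (unique⁺ (sideᵘ-diamond cx ct) (chord-diamond x≢y cx cy)))

    two-common⇒no-triangleᵛ : ∀ {x y t} → CommonNeighbour u v x → CommonNeighbour u v y → x ≢ y →
                              ¬ CommonNeighbour v x t
    two-common⇒no-triangleᵛ cx cy x≢y ct =
      [ u≢v ∘ sym ∘ proj₁ , ~⇒≢ (proj₁ cx) ∘ sym ∘ proj₂ ]′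
        (proj₁ (unique⁺ (sideᵛ-diamond cx ct) (chord-diamond x≢y cx cy)))

    no-triangles-on-both-sides : ∀ {x t s} → CommonNeighbour u v x →
                                 CommonNeighbour u x t → ¬ CommonNeighbour v x s
    no-triangles-on-both-sides cx ct cs =
      [ u≢v ∘ proj₁ , ~⇒≢ (proj₁ cx) ∘ proj₁ ]′
        (proj₁ (unique⁺ (sideᵘ-diamond cx ct) (sideᵛ-diamond cx cs)))

    common-neighbour : ∃ (CommonNeighbour u v)
    common-neighbour = of completion
      where
      of : Completion u v → ∃ (CommonNeighbour u v)
      of (chord _ cc _) = _ , cc
      of (sideᵘ cx _)   = _ , cx
      of (sideᵛ cx _)   = _ , cx

    second-common-neighbour : ∀ {x} → ¬ ∃ (CommonNeighbour u x) → ¬ ∃ (CommonNeighbour v x) →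
                              ∃[ y ] y ≢ x × CommonNeighbour u v y
    second-common-neighbour {x} ∄ᵘ ∄ᵛ = of completion
      where
      of : Completion u v → ∃[ y ] y ≢ x × CommonNeighbour u v y
      of (chord {c} {d} c≢d cc cd) with c ≟ x
      ... | yes refl = d , ≢-sym c≢d , cd
      ... | no c≢x   = c , c≢x , cc
      of (sideᵘ {y} cy ct) with y ≟ x
      ... | yes refl = contradiction (_ , ct) ∄ᵘ
      ... | no y≢x   = y , y≢x , cy
      of (sideᵛ {y} cy ct) with y ≟ x
      ... | yes refl = contradiction (_ , ct) ∄ᵛ
      ... | no y≢x   = y , y≢x , cy

  triangle-partners : ∀ {v b c w} → Triangle v b c → TriangleEdge v w → w ≡ b ⊎ w ≡ c
  triangle-partners {v} {b} {c} {w} (v~b , v~c , b~c) (v~w , t , v~t , w~t) with w ≟ b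
  ... | yes w≡b = inj₁ w≡b
  ... | no w≢b with b ~? w
  ...   | yes b~w = inj₂ (triangle-edge-unique v~b (v~w , b~w) (v~c , b~c))
  ...   | no b≁w  = ⊥-elim (NonEdge.no-triangles-on-both-sides (≢-sym w≢b) b≁w
                              (~-sym v~b , ~-sym v~w) (b~c , v~c) (w~t , v~t))

  -- For a plain neighbour w ≠ u of x, the vertices u and w are non-adjacent with no triangle on ux or wx,
  -- so they have a second common neighbour y, which is a plain neighbour of u; w ↦ y is injective because
  -- the non-adjacent x and y have at most two common neighbours.
  private
    plainDeg-≤ : ∀ {u x} → PlainEdge u x → plainDeg x ≤ plainDeg u
    plainDeg-≤ {u} {x} u-x@(u~x , ∄ux) = begin
      plainDeg x                ≡⟨ count-remove (PlainEdge? x) (plainEdge-sym u-x) ⟩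
      suc (count Others-of-x)   ≤⟨ s≤s (count-injection Others-of-x Others-of-u
                                          (proj₁ ∘ partner) (proj₁ ∘ proj₂ ∘ partner) partner-injective) ⟩
      suc (count Others-of-u)   ≡⟨ count-remove (PlainEdge? u) u-x ⟨
      plainDeg u                ∎
      where
      open ≤-Reasoning
      Others-of-x Others-of-u : Decidable₁ _
      Others-of-x w = PlainEdge? x w ×-dec ¬? (w ≟ u)
      Others-of-u y = PlainEdge? u y ×-dec ¬? (y ≟ x)

      partner : ∀ {w} → PlainEdge x w × w ≢ u → ∃[ y ] (PlainEdge u y × y ≢ x) × CommonNeighbour u w y
      partner {w} (x-w@(x~w , ∄xw) , w≢u) =
        plain (NonEdge.second-common-neighbour (≢-sym w≢u) u≁w ∄ux λ (t , w~t , x~t) → ∄xw (t , x~t , w~t))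
        where
        u≁w : ¬ u ~ w
        u≁w u~w = ∄ux (w , u~w , x~w)
        plain : ∃[ y ] y ≢ x × CommonNeighbour u w y → ∃[ y ] (PlainEdge u y × y ≢ x) × CommonNeighbour u w y
        plain (y , y≢x , cy@(u~y , _)) = y , ((u~y , no-triangle) , y≢x) , cy
          where
          no-triangle : ¬ ∃ (CommonNeighbour u y)
          no-triangle (_ , ct) = NonEdge.two-common⇒no-triangleᵘ (≢-sym w≢u) u≁w cy (u~x , ~-sym x~w) y≢x ct

      partner-injective : ∀ {w₁ w₂} (p₁ : PlainEdge x w₁ × w₁ ≢ u) (p₂ : PlainEdge x w₂ × w₂ ≢ u) →
                          proj₁ (partner p₁) ≡ proj₁ (partner p₂) → w₁ ≡ w₂
      partner-injective {w₁} {w₂} p₁@((x~w₁ , _) , w₁≢u) p₂@((x~w₂ , _) , w₂≢u) =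
        same-partner (partner p₁) (partner p₂)
        where
        same-partner : (r₁ : ∃[ y ] (PlainEdge u y × y ≢ x) × CommonNeighbour u w₁ y)
                       (r₂ : ∃[ y ] (PlainEdge u y × y ≢ x) × CommonNeighbour u w₂ y) →
                       proj₁ r₁ ≡ proj₁ r₂ → w₁ ≡ w₂
        same-partner (y , (_ , y≢x) , u~y , w₁~y) (_ , _ , _ , w₂~y) refl =
          decidable-stable (w₁ ≟ w₂) λ w₁≢w₂ →
            NonEdge.at-most-two-common-neighbours (≢-sym y≢x) (λ x~y → ∄ux (y , u~y , x~y))
              (~-sym u~x , ~-sym u~y) (x~w₁ , ~-sym w₁~y) (x~w₂ , ~-sym w₂~y)
              (≢-sym w₁≢u) (≢-sym w₂≢u) w₁≢w₂

  plainDeg-constant : ∀ {u x} → PlainEdge u x → plainDeg x ≡ plainDeg u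
  plainDeg-constant u-x = ≤-antisym (plainDeg-≤ u-x) (plainDeg-≤ (plainEdge-sym u-x))

  weight : Fin n → Fin n → Fin n → ℕ
  weight v x w = ⟦ CommonNeighbour? v w x ⟧ * (1 + ⟦ TriangleEdge? v x ⟧ + ⟦ TriangleEdge? x w ⟧)

  weight-common : ∀ {v x w} → CommonNeighbour v w x →
                  weight v x w ≡ 1 + ⟦ TriangleEdge? v x ⟧ + ⟦ TriangleEdge? x w ⟧
  weight-common {v} {x} {w} cn rewrite ⟦⟧-yes (CommonNeighbour? v w x) cn = +-identityʳ _

  weight-zero : ∀ {v x w} → ¬ CommonNeighbour v w x → weight v x w ≡ 0
  weight-zero {v} {x} {w} ¬cn rewrite ⟦⟧-no (CommonNeighbour? v w x) ¬cn = refl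

  weight-sum : ∀ {v w} → NonNeighbour v w → sum (λ x → weight v x w) ≡ 2
  weight-sum {v} {w} (w≢v , v≁w) = by-completion completion
    where
    open NonEdge (≢-sym w≢v) v≁w
    open ≡-Reasoning

    weight-one : ∀ {x y} → CommonNeighbour v w x → CommonNeighbour v w y → x ≢ y → weight v x w ≡ 1
    weight-one {x} cx cy x≢y = trans (weight-common cx) (cong₂ (λ p q → 1 + p + q)
      (⟦⟧-no (TriangleEdge? v x) λ (_ , _ , ct) → two-common⇒no-triangleᵘ cx cy x≢y ct)
      (⟦⟧-no (TriangleEdge? x w) λ (_ , _ , x~t , w~t) → two-common⇒no-triangleᵛ cx cy x≢y (w~t , x~t)))

    by-completion : Completion v w → sum (λ x → weight v x w) ≡ 2
    by-completion (chord {c} {d} c≢d cc cd) = begin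
      sum (λ x → weight v x w)     ≡⟨ sum-support₂ _ c d c≢d (λ l l≢c l≢d → weight-zero λ cl →
                                        at-most-two-common-neighbours cc cd cl c≢d (≢-sym l≢c) (≢-sym l≢d)) ⟩
      weight v c w + weight v d w  ≡⟨ cong₂ _+_ (weight-one cc cd c≢d) (weight-one cd cc (≢-sym c≢d)) ⟩
      2                            ∎
    by-completion (sideᵘ {x} cx@(v~x , _) ct) = begin
      sum (λ x → weight v x w)     ≡⟨ sum-support₁ _ x (λ l l≢x → weight-zero λ cl →
                                        two-common⇒no-triangleᵘ cx cl (≢-sym l≢x) ct) ⟩
      weight v x w                 ≡⟨ weight-common cx ⟩
      1 + ⟦ TriangleEdge? v x ⟧ + ⟦ TriangleEdge? x w ⟧
                                   ≡⟨ cong₂ (λ p q → 1 + p + q) (⟦⟧-yes (TriangleEdge? v x) (v~x , _ , ct))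
                                        (⟦⟧-no (TriangleEdge? x w) λ (_ , _ , x~s , w~s) →
                                           no-triangles-on-both-sides cx ct (w~s , x~s)) ⟩
      2                            ∎
    by-completion (sideᵛ {x} cx@(_ , w~x) ct@(w~t , x~t)) = begin
      sum (λ x → weight v x w)     ≡⟨ sum-support₁ _ x (λ l l≢x → weight-zero λ cl →
                                        two-common⇒no-triangleᵛ cx cl (≢-sym l≢x) ct) ⟩
      weight v x w                 ≡⟨ weight-common cx ⟩
      1 + ⟦ TriangleEdge? v x ⟧ + ⟦ TriangleEdge? x w ⟧
                                   ≡⟨ cong₂ (λ p q → 1 + p + q)
                                        (⟦⟧-no (TriangleEdge? v x) λ (_ , _ , cs) →
                                           no-triangles-on-both-sides cx cs ct)
                                        (⟦⟧-yes (TriangleEdge? x w) (~-sym w~x , _ , x~t , w~t)) ⟩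
      2                            ∎

  contribution : Fin n → Fin n → ℕ
  contribution v x = sum λ w → ⟦ NonNeighbour? v w ⟧ * weight v x w

  contribution-nonadjacent : ∀ {v x} → ¬ v ~ x → contribution v x ≡ 0
  contribution-nonadjacent {v} v≁x = sum-zero λ w →
    trans (cong (⟦ NonNeighbour? v w ⟧ *_) (weight-zero (v≁x ∘ proj₁))) (*-zeroʳ ⟦ NonNeighbour? v w ⟧)

  contribution-triangle : ∀ {v x} → TriangleEdge v x → contribution v x ≡ 2 * plainDeg x
  contribution-triangle {v} {x} v-x@(v~x , t , v~t , x~t) =
    trans (sum-cong-≗ pointwise) (sym (*-distribˡ-sum 2 (λ w → ⟦ PlainEdge? x w ⟧)))
    where
    pointwise : ∀ w → ⟦ NonNeighbour? v w ⟧ * weight v x w ≡ 2 * ⟦ PlainEdge? x w ⟧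
    pointwise w = [ non , [ tri , plain ]′ ]′ (neighbour-kind x w)
      where
      non : ¬ x ~ w → ⟦ NonNeighbour? v w ⟧ * weight v x w ≡ 2 * ⟦ PlainEdge? x w ⟧
      non x≁w rewrite weight-zero {v} {x} {w} (x≁w ∘ ~-sym ∘ proj₂)
                    | ⟦⟧-no (PlainEdge? x w) (x≁w ∘ proj₁) = *-zeroʳ ⟦ NonNeighbour? v w ⟧
      tri : TriangleEdge x w → ⟦ NonNeighbour? v w ⟧ * weight v x w ≡ 2 * ⟦ PlainEdge? x w ⟧
      tri x-w rewrite ⟦⟧-no (PlainEdge? x w) (triangle⇒¬plain x-w)
                    | ⟦⟧-no (NonNeighbour? v w) (λ (w≢v , v≁w) →
                        [ w≢v , (λ { refl → v≁w v~t }) ]′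
                          (triangle-partners (~-sym v~x , x~t , v~t) x-w)) = refl
      plain : PlainEdge x w → ⟦ NonNeighbour? v w ⟧ * weight v x w ≡ 2 * ⟦ PlainEdge? x w ⟧
      plain x-w@(x~w , ∄xw)
        rewrite ⟦⟧-yes (PlainEdge? x w) x-w
              | ⟦⟧-yes (NonNeighbour? v w) ((λ { refl → triangle⇒¬plain v-x (plainEdge-sym x-w) })
                                           , λ v~w → ∄xw (v , ~-sym v~x , ~-sym v~w))
              | weight-common {v} {x} {w} (v~x , ~-sym x~w)
              | ⟦⟧-yes (TriangleEdge? v x) v-x
              | ⟦⟧-no (TriangleEdge? x w) (λ t → triangle⇒¬plain t x-w) = refl

  contribution-plain : ∀ {v x} → PlainEdge v x → contribution v x + 1 ≡ plainDeg x + 2 * triDeg x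
  contribution-plain {v} {x} v-x@(v~x , ∄vx) = begin
    contribution v x + 1
      ≡⟨ cong (contribution v x +_) (count-singleton v) ⟨
    contribution v x + count (_≟ v)
      ≡⟨ ∑-distrib-+ (λ w → ⟦ NonNeighbour? v w ⟧ * weight v x w) (λ w → ⟦ w ≟ v ⟧) ⟨
    sum (λ w → ⟦ NonNeighbour? v w ⟧ * weight v x w + ⟦ w ≟ v ⟧)
      ≡⟨ sum-cong-≗ pointwise ⟩
    sum (λ w → ⟦ PlainEdge? x w ⟧ + 2 * ⟦ TriangleEdge? x w ⟧)
      ≡⟨ ∑-distrib-+ (λ w → ⟦ PlainEdge? x w ⟧) (λ w → 2 * ⟦ TriangleEdge? x w ⟧) ⟩
    plainDeg x + sum (λ w → 2 * ⟦ TriangleEdge? x w ⟧)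
      ≡⟨ cong (plainDeg x +_) (*-distribˡ-sum 2 (λ w → ⟦ TriangleEdge? x w ⟧)) ⟨
    plainDeg x + 2 * triDeg x
      ∎
    where
    open ≡-Reasoning
    Goal : Fin n → Set
    Goal w = ⟦ NonNeighbour? v w ⟧ * weight v x w + ⟦ w ≟ v ⟧ ≡ ⟦ PlainEdge? x w ⟧ + 2 * ⟦ TriangleEdge? x w ⟧

    at-v : Goal v
    at-v rewrite ⟦⟧-no (NonNeighbour? v v) (λ (v≢v , _) → v≢v refl)
               | ⟦⟧-yes (v ≟ v) refl
               | ⟦⟧-yes (PlainEdge? x v) (plainEdge-sym v-x)
               | ⟦⟧-no (TriangleEdge? x v) (λ t → triangle⇒¬plain t (plainEdge-sym v-x)) = refl

    elsewhere : ∀ {w} → w ≢ v → Goal w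
    elsewhere {w} w≢v = [ non , [ tri , plain ]′ ]′ (neighbour-kind x w)
      where
      non : ¬ x ~ w → Goal w
      non x≁w rewrite ⟦⟧-no (w ≟ v) w≢v
                    | weight-zero {v} {x} {w} (x≁w ∘ ~-sym ∘ proj₂)
                    | ⟦⟧-no (PlainEdge? x w) (x≁w ∘ proj₁)
                    | ⟦⟧-no (TriangleEdge? x w) (x≁w ∘ proj₁) =
        trans (+-identityʳ _) (*-zeroʳ ⟦ NonNeighbour? v w ⟧)
      common : x ~ w → ⟦ NonNeighbour? v w ⟧ * weight v x w + ⟦ w ≟ v ⟧ ≡ 1 + ⟦ TriangleEdge? x w ⟧
      common x~w rewrite ⟦⟧-no (w ≟ v) w≢v
                       | ⟦⟧-yes (NonNeighbour? v w) (w≢v , λ v~w → ∄vx (w , v~w , x~w))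
                       | weight-common {v} {x} {w} (v~x , ~-sym x~w)
                       | ⟦⟧-no (TriangleEdge? v x) (λ t → triangle⇒¬plain t v-x) =
        trans (+-identityʳ _) (+-identityʳ _)
      tri : TriangleEdge x w → Goal w
      tri x-w rewrite common (proj₁ x-w)
                    | ⟦⟧-yes (TriangleEdge? x w) x-w
                    | ⟦⟧-no (PlainEdge? x w) (triangle⇒¬plain x-w) = refl
      plain : PlainEdge x w → Goal w
      plain x-w rewrite common (proj₁ x-w)
                      | ⟦⟧-no (TriangleEdge? x w) (λ t → triangle⇒¬plain t x-w)
                      | ⟦⟧-yes (PlainEdge? x w) x-w = refl

    pointwise : ∀ w → Goal w
    pointwise w = [ (λ { refl → at-v }) , elsewhere ]′ (toSum (w ≟ v))

  ΣplainDeg-triNbrs ΣtriDeg-plainNbrs : Fin n → ℕ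
  ΣplainDeg-triNbrs v = sum λ x → ⟦ TriangleEdge? v x ⟧ * plainDeg x
  ΣtriDeg-plainNbrs v = sum λ x → ⟦ PlainEdge? v x ⟧ * triDeg x

  contribution-identity : ∀ v x →
    contribution v x + ⟦ PlainEdge? v x ⟧ ≡
    2 * (⟦ TriangleEdge? v x ⟧ * plainDeg x) +
    (⟦ PlainEdge? v x ⟧ * plainDeg v + 2 * (⟦ PlainEdge? v x ⟧ * triDeg x))
  contribution-identity v x = [ non , [ tri , plain ]′ ]′ (neighbour-kind v x)
    where
    Tri? : Dec (TriangleEdge v x)
    Tri? = TriangleEdge? v x
    Plain? : Dec (PlainEdge v x)
    Plain? = PlainEdge? v x

    rhs≡ : ∀ {a b c} → ⟦ Tri? ⟧ * plainDeg x ≡ a → ⟦ Plain? ⟧ * plainDeg v ≡ b → ⟦ Plain? ⟧ * triDeg x ≡ c →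
           2 * (⟦ Tri? ⟧ * plainDeg x) + (⟦ Plain? ⟧ * plainDeg v + 2 * (⟦ Plain? ⟧ * triDeg x)) ≡
           2 * a + (b + 2 * c)
    rhs≡ refl refl refl = refl

    non : ¬ v ~ x → _
    non v≁x = trans (cong₂ _+_ (contribution-nonadjacent v≁x) (⟦⟧-no Plain? ¬plain))
                    (sym (rhs≡ (⟦⟧*-no Tri? (v≁x ∘ proj₁) _) (⟦⟧*-no Plain? ¬plain _) (⟦⟧*-no Plain? ¬plain _)))
      where ¬plain = v≁x ∘ proj₁

    tri : TriangleEdge v x → _
    tri v-x = trans (cong₂ _+_ (contribution-triangle v-x) (⟦⟧-no Plain? ¬plain))
                    (sym (rhs≡ (⟦⟧*-yes Tri? v-x _) (⟦⟧*-no Plain? ¬plain _) (⟦⟧*-no Plain? ¬plain _)))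
      where ¬plain = triangle⇒¬plain v-x

    plain : PlainEdge v x → _
    plain v-x = begin
      contribution v x + ⟦ Plain? ⟧  ≡⟨ cong (contribution v x +_) (⟦⟧-yes Plain? v-x) ⟩
      contribution v x + 1           ≡⟨ contribution-plain v-x ⟩
      plainDeg x + 2 * triDeg x      ≡⟨ cong (_+ 2 * triDeg x) (plainDeg-constant v-x) ⟩
      plainDeg v + 2 * triDeg x      ≡⟨ rhs≡ (⟦⟧*-no Tri? (λ t → triangle⇒¬plain t v-x) _)
                                             (⟦⟧*-yes Plain? v-x _) (⟦⟧*-yes Plain? v-x _) ⟨
      _                              ∎
      where open ≡-Reasoning

  ∑contribution : ∀ v → sum (contribution v) ≡ 2 * nonDeg v
  ∑contribution v = begin
    sum (λ x → sum λ w → ⟦ NonNeighbour? v w ⟧ * weight v x w)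
      ≡⟨ ∑-comm (λ x w → ⟦ NonNeighbour? v w ⟧ * weight v x w) ⟩
    sum (λ w → sum λ x → ⟦ NonNeighbour? v w ⟧ * weight v x w)
      ≡⟨ sum-cong-≗ (λ w → *-distribˡ-sum ⟦ NonNeighbour? v w ⟧ (λ x → weight v x w)) ⟨
    sum (λ w → ⟦ NonNeighbour? v w ⟧ * sum (λ x → weight v x w))
      ≡⟨ sum-cong-≗ weighted ⟩
    sum (λ w → 2 * ⟦ NonNeighbour? v w ⟧)
      ≡⟨ *-distribˡ-sum 2 (λ w → ⟦ NonNeighbour? v w ⟧) ⟨
    2 * nonDeg v
      ∎
    where
    open ≡-Reasoning
    weighted : ∀ w → ⟦ NonNeighbour? v w ⟧ * sum (λ x → weight v x w) ≡ 2 * ⟦ NonNeighbour? v w ⟧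
    weighted w = [ (λ nn → trans (cong₂ _*_ (⟦⟧-yes (NonNeighbour? v w) nn) (weight-sum nn))
                                 (sym (cong (2 *_) (⟦⟧-yes (NonNeighbour? v w) nn))))
                 , (λ ¬nn → trans (cong (_* sum (λ x → weight v x w)) (⟦⟧-no (NonNeighbour? v w) ¬nn))
                                  (sym (cong (2 *_) (⟦⟧-no (NonNeighbour? v w) ¬nn))))
                 ]′ (toSum (NonNeighbour? v w))

  double-count : ∀ v →
    2 * nonDeg v + plainDeg v ≡ 2 * ΣplainDeg-triNbrs v + (plainDeg v * plainDeg v + 2 * ΣtriDeg-plainNbrs v)
  double-count v = begin
    2 * nonDeg v + plainDeg v
      ≡⟨ cong (_+ plainDeg v) (∑contribution v) ⟨
    sum (contribution v) + sum plain
      ≡⟨ ∑-distrib-+ (contribution v) plain ⟨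
    sum (λ x → contribution v x + plain x)
      ≡⟨ sum-cong-≗ (contribution-identity v) ⟩
    sum (λ x → 2 * tri x + (plain x * plainDeg v + 2 * triDeg′ x))
      ≡⟨ ∑-distrib-+ (λ x → 2 * tri x) (λ x → plain x * plainDeg v + 2 * triDeg′ x) ⟩
    sum (λ x → 2 * tri x) + sum (λ x → plain x * plainDeg v + 2 * triDeg′ x)
      ≡⟨ cong (sum (λ x → 2 * tri x) +_) (∑-distrib-+ (λ x → plain x * plainDeg v) (λ x → 2 * triDeg′ x)) ⟩
    sum (λ x → 2 * tri x) + (sum (λ x → plain x * plainDeg v) + sum (λ x → 2 * triDeg′ x))
      ≡⟨ cong₂ (λ a b → a + (b + sum (λ x → 2 * triDeg′ x)))
               (*-distribˡ-sum 2 tri) (*-distribʳ-sum (plainDeg v) plain) ⟨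
    2 * sum tri + (sum plain * plainDeg v + sum (λ x → 2 * triDeg′ x))
      ≡⟨ cong (λ c → 2 * sum tri + (sum plain * plainDeg v + c)) (*-distribˡ-sum 2 triDeg′) ⟨
    2 * sum tri + (sum plain * plainDeg v + 2 * sum triDeg′)
      ∎
    where
    open ≡-Reasoning
    tri plain triDeg′ : Fin n → ℕ
    tri     x = ⟦ TriangleEdge? v x ⟧ * plainDeg x
    plain   x = ⟦ PlainEdge? v x ⟧
    triDeg′ x = ⟦ PlainEdge? v x ⟧ * triDeg x

  vertex-equation : ∀ v →
    2 * n ≡ 2 + plainDeg v * suc (plainDeg v) + 2 * (triDeg v + ΣplainDeg-triNbrs v + ΣtriDeg-plainNbrs v)
  vertex-equation v =
    combine n (plainDeg v) (triDeg v) (nonDeg v) (ΣplainDeg-triNbrs v) (ΣtriDeg-plainNbrs v)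
            (vertex-partition v) (double-count v)
    where
    combine : ∀ N B M K S Q → N ≡ suc (B + M + K) → 2 * K + B ≡ 2 * S + (B * B + 2 * Q) →
              2 * N ≡ 2 + B * suc B + 2 * (M + S + Q)
    combine _ B M K S Q refl eq = +-cancelʳ-≡ B _ _ (begin
      2 * suc (B + M + K) + B                          ≡⟨ expand B M K ⟩
      2 + 2 * B + 2 * M + (2 * K + B)                  ≡⟨ cong (2 + 2 * B + 2 * M +_) eq ⟩
      2 + 2 * B + 2 * M + (2 * S + (B * B + 2 * Q))    ≡⟨ regroup B M S Q ⟩
      2 + B * suc B + 2 * (M + S + Q) + B              ∎)
      where
      open ≡-Reasoning
      expand : ∀ B M K → 2 * suc (B + M + K) + B ≡ 2 + 2 * B + 2 * M + (2 * K + B)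
      expand = solve-∀
      regroup : ∀ B M S Q → 2 + 2 * B + 2 * M + (2 * S + (B * B + 2 * Q)) ≡ 2 + B * suc B + 2 * (M + S + Q) + B
      regroup = solve-∀

  sum-over-triangle-partners : ∀ {v b c} → Triangle v b c → (f : Fin n → ℕ) →
                               sum (λ w → ⟦ TriangleEdge? v w ⟧ * f w) ≡ f b + f c
  sum-over-triangle-partners {v} {b} {c} vbc@(v~b , v~c , b~c) f =
    trans (sum-support₂ _ b c (~⇒≢ b~c) λ w w≢b w≢c →
             ⟦⟧*-no (TriangleEdge? v w) (λ v-w → [ w≢b , w≢c ]′ (triangle-partners vbc v-w)) (f w))
          (cong₂ _+_ (⟦⟧*-yes (TriangleEdge? v b) (v~b , c , v~c , b~c) (f b))
                     (⟦⟧*-yes (TriangleEdge? v c) (v~c , b , v~b , ~-sym b~c) (f c)))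

  triDeg-in-triangle : ∀ {v b c} → Triangle v b c → triDeg v ≡ 2
  triDeg-in-triangle {v} vbc =
    trans (sum-cong-≗ λ w → sym (*-identityʳ ⟦ TriangleEdge? v w ⟧)) (sum-over-triangle-partners vbc λ _ → 1)

  triDeg-outside-triangles : ∀ {v} → ¬ InTriangle v → triDeg v ≡ 0
  triDeg-outside-triangles v∉ = count-none (TriangleEdge? _) λ _ → v∉ ∘ triangleEdge⇒inTriangle

  ΣplainDeg-triNbrs-outside-triangles : ∀ {v} → ¬ InTriangle v → ΣplainDeg-triNbrs v ≡ 0
  ΣplainDeg-triNbrs-outside-triangles {v} v∉ = sum-zero λ w →
    cong (_* plainDeg w) (⟦⟧-no (TriangleEdge? v w) (v∉ ∘ triangleEdge⇒inTriangle))

  vertex-equation-in-triangle : ∀ {v b c} → Triangle v b c →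
    2 * n ≡ 2 + plainDeg v * suc (plainDeg v) + 2 * (2 + (plainDeg b + plainDeg c) + ΣtriDeg-plainNbrs v)
  vertex-equation-in-triangle {v} vbc =
    trans (vertex-equation v)
          (cong₂ (λ m σ → 2 + plainDeg v * suc (plainDeg v) + 2 * (m + σ + ΣtriDeg-plainNbrs v))
                 (triDeg-in-triangle vbc) (sum-over-triangle-partners vbc plainDeg))

  vertex-equation-outside-triangles : ∀ {v} → ¬ InTriangle v →
    2 * n ≡ 2 + plainDeg v * suc (plainDeg v) + 2 * ΣtriDeg-plainNbrs v
  vertex-equation-outside-triangles {v} v∉ =
    trans (vertex-equation v)
          (cong₂ (λ m σ → 2 + plainDeg v * suc (plainDeg v) + 2 * (m + σ + ΣtriDeg-plainNbrs v))
                 (triDeg-outside-triangles v∉) (ΣplainDeg-triNbrs-outside-triangles v∉))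

  plainNbrsInTriangles : Fin n → ℕ
  plainNbrsInTriangles v = count λ y → PlainEdge? v y ×-dec InTriangle? y

  -- Send y to the least vertex of its triangle: since a vertex lies in at most one triangle and two plain
  -- neighbours of v are never adjacent, distinct y give distinct triangles.
  plainNbrsInTriangles≤triangles : ∀ v → plainNbrsInTriangles v ≤ triangles (adj G)
  plainNbrsInTriangles≤triangles v = begin
    plainNbrsInTriangles v
      ≤⟨ count-injection (λ y → PlainEdge? v y ×-dec InTriangle? y) Leader?
                         (proj₁ ∘ leader) (proj₂ ∘ proj₂ ∘ leader) leader-injective ⟩
    count Leader?
      ≤⟨ sum-mono-≤ (λ r → ⟦leader⟧≤ (trianglesFrom r)) ⟩
    sum trianglesFrom
      ≡⟨ triangles≡sum ⟨
    triangles (adj G)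
      ∎
    where
    open ≤-Reasoning
    Leader? : Decidable₁ λ r → 0 < trianglesFrom r
    Leader? r = 1 ≤? trianglesFrom r

    ⟦leader⟧≤ : ∀ m → ⟦ 1 ≤? m ⟧ ≤ m
    ⟦leader⟧≤ m = [ (λ 1≤m → ≤-trans (≤-reflexive (⟦⟧-yes (1 ≤? m) 1≤m)) 1≤m)
                  , (λ 1≰m → ≤-trans (≤-reflexive (⟦⟧-no (1 ≤? m) 1≰m)) z≤n) ]′ (toSum (1 ≤? m))

    leader : ∀ {y} → PlainEdge v y × InTriangle y → ∃[ r ] (r ≡ y ⊎ TriangleEdge y r) × 0 < trianglesFrom r
    leader (_ , p , q , ypq@(y~p , y~q , p~q)) with least-vertex ypq
    ... | r , inj₁ refl , pos        = r , inj₁ refl , pos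
    ... | r , inj₂ (inj₁ refl) , pos = r , inj₂ (y~p , q , y~q , p~q) , pos
    ... | r , inj₂ (inj₂ refl) , pos = r , inj₂ (y~q , p , y~p , ~-sym p~q) , pos

    same-triangle : ∀ {y₁ y₂ r} → r ≡ y₁ ⊎ TriangleEdge y₁ r → r ≡ y₂ ⊎ TriangleEdge y₂ r → y₁ ≡ y₂ ⊎ y₁ ~ y₂
    same-triangle (inj₁ refl) (inj₁ refl) = inj₁ refl
    same-triangle (inj₁ refl) (inj₂ t₂)   = inj₂ (~-sym (proj₁ t₂))
    same-triangle (inj₂ t₁)   (inj₁ refl) = inj₂ (proj₁ t₁)
    same-triangle (inj₂ (y₁~r , t , y₁~t , r~t)) (inj₂ t₂)
      with triangle-partners (~-sym y₁~r , r~t , y₁~t) (triangleEdge-sym t₂)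
    ... | inj₁ refl = inj₁ refl
    ... | inj₂ refl = inj₂ y₁~t

    leader-injective : ∀ {y₁ y₂} (p₁ : PlainEdge v y₁ × InTriangle y₁) (p₂ : PlainEdge v y₂ × InTriangle y₂) →
                       proj₁ (leader p₁) ≡ proj₁ (leader p₂) → y₁ ≡ y₂
    leader-injective {y₁} {y₂} p₁@(v-y₁ , _) p₂@(v-y₂ , _) = same-leader (leader p₁) (leader p₂)
      where
      same-leader : (r₁ : ∃[ r ] (r ≡ y₁ ⊎ TriangleEdge y₁ r) × 0 < trianglesFrom r)
                    (r₂ : ∃[ r ] (r ≡ y₂ ⊎ TriangleEdge y₂ r) × 0 < trianglesFrom r) →
                    proj₁ r₁ ≡ proj₁ r₂ → y₁ ≡ y₂
      same-leader (_ , rel₁ , _) (_ , rel₂ , _) refl =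
        [ (λ y₁≡y₂ → y₁≡y₂) , (λ y₁~y₂ → contradiction y₁~y₂ (plain-neighbours-nonadjacent v-y₁ v-y₂)) ]′
          (same-triangle rel₁ rel₂)

  ΣtriDeg-plainNbrs≤ : ∀ v → ΣtriDeg-plainNbrs v ≤ 2 * plainNbrsInTriangles v
  ΣtriDeg-plainNbrs≤ v =
    ≤-trans (sum-mono-≤ pointwise)
            (≤-reflexive (sym (*-distribˡ-sum 2 λ y → ⟦ PlainEdge? v y ×-dec InTriangle? y ⟧)))
    where
    pointwise : ∀ y → ⟦ PlainEdge? v y ⟧ * triDeg y ≤ 2 * ⟦ PlainEdge? v y ×-dec InTriangle? y ⟧
    pointwise y = [ inside , outside ]′ (toSum (InTriangle? y))
      where
      inside : InTriangle y → ⟦ PlainEdge? v y ⟧ * triDeg y ≤ 2 * ⟦ PlainEdge? v y ×-dec InTriangle? y ⟧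
      inside y∈@(_ , _ , ybc) = ≤-reflexive (begin
        ⟦ PlainEdge? v y ⟧ * triDeg y               ≡⟨ cong (⟦ PlainEdge? v y ⟧ *_) (triDeg-in-triangle ybc) ⟩
        ⟦ PlainEdge? v y ⟧ * 2                      ≡⟨ *-comm ⟦ PlainEdge? v y ⟧ 2 ⟩
        2 * ⟦ PlainEdge? v y ⟧                      ≡⟨ cong (2 *_) (⟦×-dec⟧ʳ (PlainEdge? v y) (InTriangle? y) y∈) ⟨
        2 * ⟦ PlainEdge? v y ×-dec InTriangle? y ⟧  ∎)
        where open ≡-Reasoning
      outside : ¬ InTriangle y → ⟦ PlainEdge? v y ⟧ * triDeg y ≤ 2 * ⟦ PlainEdge? v y ×-dec InTriangle? y ⟧
      outside y∉ = ≤-trans (≤-reflexive (trans (cong (⟦ PlainEdge? v y ⟧ *_) (triDeg-outside-triangles y∉))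
                                               (*-zeroʳ ⟦ PlainEdge? v y ⟧))) z≤n

  plainDeg-via-neighbour : ∀ {u w} → ¬ InTriangle u → u ~ w → plainDeg w ≡ plainDeg u
  plainDeg-via-neighbour u∉ u~w = plainDeg-constant (u~w , λ (_ , u~t , w~t) → u∉ (_ , _ , u~w , u~t , w~t))

  triangle-with-plainDeg-of : ∀ {u p q s} → ¬ InTriangle u → Triangle p q s →
                              ∃[ a ] ∃[ b ] ∃[ c ] Triangle a b c × plainDeg a ≡ plainDeg u
  triangle-with-plainDeg-of {u} {p} {q} {s} u∉ pqs@(p~q , p~s , q~s) with u ~? p | u ~? q | u ~? s
  ... | yes u~p | _       | _       = p , q , s , pqs , plainDeg-via-neighbour u∉ u~p
  ... | no _    | yes u~q | _       = q , p , s , triangle-swapˡ pqs , plainDeg-via-neighbour u∉ u~q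
  ... | no _    | no _    | yes u~s =
    s , p , q , triangle-swapˡ (triangle-swapʳ pqs) , plainDeg-via-neighbour u∉ u~s
  ... | no u≁p  | no u≁q  | no u≁s  = p , q , s , pqs , via (NonEdge.common-neighbour u≢p u≁p)
    where
    u≢p : u ≢ p
    u≢p refl = u∉ (q , s , pqs)
    via : ∃ (CommonNeighbour u p) → plainDeg p ≡ plainDeg u
    via (x , u~x , p~x) = [ triangle-edge , plain-edge ]′ (edge-kind p~x)
      where
      triangle-edge : TriangleEdge p x → plainDeg p ≡ plainDeg u
      triangle-edge p-x =
        ⊥-elim ([ (λ { refl → u≁q u~x }) , (λ { refl → u≁s u~x }) ]′ (triangle-partners pqs p-x))
      plain-edge : PlainEdge p x → plainDeg p ≡ plainDeg u
      plain-edge p-x = trans (sym (plainDeg-constant p-x)) (plainDeg-via-neighbour u∉ u~x)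

  module _ {k : ℕ} (triangles≡k : triangles (adj G) ≡ k) where

    plainNbrsInTriangles≤k : ∀ v → plainNbrsInTriangles v ≤ k
    plainNbrsInTriangles≤k v = subst (plainNbrsInTriangles v ≤_) triangles≡k (plainNbrsInTriangles≤triangles v)

    ΣtriDeg-plainNbrs≤2k : ∀ v → ΣtriDeg-plainNbrs v ≤ 2 * k
    ΣtriDeg-plainNbrs≤2k v = ≤-trans (ΣtriDeg-plainNbrs≤ v) (*-monoʳ-≤ 2 (plainNbrsInTriangles≤k v))

    order-bound-all-in-triangles : (∀ v → InTriangle v) → ∀ {v} → InTriangle v →
                                   2 * n ≤ 2 + k * suc k + 2 * (2 + (k + k) + 2 * k)
    order-bound-all-in-triangles all-in {v} (b , c , vbc) = begin
      2 * n
        ≡⟨ vertex-equation-in-triangle vbc ⟩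
      2 + plainDeg v * suc (plainDeg v) + 2 * (2 + (plainDeg b + plainDeg c) + ΣtriDeg-plainNbrs v)
        ≤⟨ +-mono-≤ (+-monoʳ-≤ 2 (*-mono-≤ (plainDeg≤k v) (s≤s (plainDeg≤k v))))
                    (*-monoʳ-≤ 2 (+-mono-≤ (+-monoʳ-≤ 2 (+-mono-≤ (plainDeg≤k b) (plainDeg≤k c)))
                                           (ΣtriDeg-plainNbrs≤2k v))) ⟩
      2 + k * suc k + 2 * (2 + (k + k) + 2 * k)
        ∎
      where
      open ≤-Reasoning
      plainDeg≤k : ∀ w → plainDeg w ≤ k
      plainDeg≤k w = ≤-trans (count-mono (PlainEdge? w) (λ y → PlainEdge? w y ×-dec InTriangle? y)
                                         (λ p → p , all-in _))
                             (plainNbrsInTriangles≤k w)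

    order-bound-outside-triangles : ∀ {u} → ¬ InTriangle u → ∃ InTriangle →
                                    2 * n ≤ 2 + suc (2 * k) * suc (suc (2 * k)) + 2 * (2 * k)
    order-bound-outside-triangles {u} u∉ (_ , _ , _ , pqs) = from-link (triangle-with-plainDeg-of u∉ pqs)
      where
      from-link : ∃[ a ] ∃[ b ] ∃[ c ] Triangle a b c × plainDeg a ≡ plainDeg u → _
      from-link (a , b , c , abc , βa≡βu) =
        outside-bound n (plainDeg u) (plainDeg b) (plainDeg c)
                      (ΣtriDeg-plainNbrs u) (ΣtriDeg-plainNbrs a) (ΣtriDeg-plainNbrs b) k
          (vertex-equation-outside-triangles u∉)
          (subst (λ β → 2 * n ≡ 2 + β * suc β + 2 * (2 + (plainDeg b + plainDeg c) + ΣtriDeg-plainNbrs a))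
                 βa≡βu (vertex-equation-in-triangle abc))
          (subst (λ β → 2 * n ≡ 2 + plainDeg b * suc (plainDeg b) +
                                2 * (2 + (β + plainDeg c) + ΣtriDeg-plainNbrs b))
                 βa≡βu (vertex-equation-in-triangle (triangle-swapˡ abc)))
          (ΣtriDeg-plainNbrs≤2k u) (ΣtriDeg-plainNbrs≤2k b)

    order-bound : 0 < k → 2 * n ≤ 4 * k * k + 10 * k + 6
    order-bound 0<k = [ all-in , some-outside ]′ (toSum (all? InTriangle?))
      where
      some-triangle : ∃ InTriangle
      some-triangle = triangles-pos⇒triangle (subst (0 <_) (sym triangles≡k) 0<k)
      slackᵃ : ∀ k → 2 + k * suc k + 2 * (2 + (k + k) + 2 * k) + (3 * k * k + k) ≡ 4 * k * k + 10 * k + 6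
      slackᵃ = solve-∀
      slackᵇ : ∀ k → 2 + suc (2 * k) * suc (suc (2 * k)) + 2 * (2 * k) + 2 ≡ 4 * k * k + 10 * k + 6
      slackᵇ = solve-∀
      all-in : (∀ v → InTriangle v) → 2 * n ≤ 4 * k * k + 10 * k + 6
      all-in ∀∈ = ≤-trans (order-bound-all-in-triangles ∀∈ (proj₂ some-triangle)) (m+n≡o⇒m≤o _ _ (slackᵃ k))
      some-outside : ¬ (∀ v → InTriangle v) → 2 * n ≤ 4 * k * k + 10 * k + 6
      some-outside ¬∀∈ =
        ≤-trans (order-bound-outside-triangles (proj₂ (¬∀⟶∃¬ n InTriangle InTriangle? ¬∀∈)) some-triangle)
                (m+n≡o⇒m≤o _ 2 (slackᵇ k))

theorem3p5 : (k n : ℕ) → 2 ≤ k → 18 * k ^ 2 ∸ 24 * k + 10 < n →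
    (G : Graph n) → UniquelyDiamondSaturated G → triangles (adj G) ≡ k → ⊥
theorem3p5 k n 2≤k n-large G sat triangles≡k =
  order-too-small 2≤k n-large (UniquelySaturated.order-bound G sat triangles≡k (≤-trans (s≤s z≤n) 2≤k))
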